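{- Let $M=(E,\mathcal{I})$ be a matroid with $E=\{1,\dots,n\}$, let $p\ge2$ and $l\ge1$ be integers, and let $(n_1,\dots,n_p)$ and $(m_1,\dots,m_p)$ be $p$-tuples of integers with $n_1+\cdots+n_p=m_1+\cdots+m_p=0$. Then \[f_{l+n_1}(M)f_{l+n_2}(M)\cdots f_{l+n_p}(M)\ \ge\ f_{l+m_1}(M)f_{l+m_2}(M)\cdots f_{l+m_p}(M)\] holds if and only if, for every integer $k\le l$ and every matroid of the form $N=M[\mathbf{X},\mathbf{q}]$ with $\mathbf{q}=(1,2,\dots,p-1)$ and $\mathbf{X}=(X_1,\dots,X_p)$ a $p$-tuple of pairwise disjoint subsets of $E$, such that $N$ has size $pk$ and depth $l-k$, we have \[\pi_{(k+n_1,\dots,k+n_p)}(N)\ge\pi_{(k+m_1,\dots,k+m_p)}(N).\]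
   Context: For $j\ge0$, $f_j(M)=\sum_{I\in\mathcal{I},|I|=j}\prod_{i\in I}x_i\in\mathbb{R}[x_1,\dots,x_n]$ (this is $0$ if $j$ exceeds the rank of $M$), and $f_j(M)=0$ for $j<0$. For polynomials, $F\ge G$ means $F-G$ has nonnegative coefficients. For a matroid $N$ with ground set $Y$ and an integer tuple $\mathbf{i}=(i_1,\dots,i_p)$, $\pi_{\mathbf{i}}(N)$ is the number of ordered set partitions $(A_1,\dots,A_p)$ of $Y$ (pairwise disjoint, union $Y$, blocks possibly empty) with each $A_s$ independent in $N$ and $|A_s|=i_s$ (so it is $0$ if some $i_s<0$ or $\sum i_s\neq|Y|$). For $X\subseteq E$ and a positive integer $q$, $M\odot X^{q}$ denotes the matroid obtained from $M$ by replacing each element $x\in X$ by $q$ elements $x=x^{(0)},x^{(1)},\dots,x^{(q-1)}$ in parallel. For disjoint $X_1,\dots,X_p\subseteq E$ and $\mathbf{q}=(q_1,\dots,q_{p-1})$ of positive integers, \[M[\mathbf{X},\mathbf{q}]=\big(M(X_1\cup\cdots\cup X_p)\odot X_1^{q_1}\cdots\odot X_{p-1}^{q_{p-1}}\big)/X_p,\] where $M(T)$ is the restriction of $M$ to $T$ and $/X_p$ denotes contraction of $X_p$. Its size is the cardinality of its ground set (here $|X_1|+2|X_2|+\cdots+(p-1)|X_{p-1}|$ when $\mathbf{q}=(1,\dots,p-1)$), and its depth is the rank of $X_p$ in $M$. -}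

module Defs where

open import Data.Bool using (Bool; true; false; _∧_; _∨_; not; if_then_else_; T)
open import Data.Nat as ℕ using (ℕ; zero; suc; _≤_; _<_; _∸_; _≡ᵇ_; _<ᵇ_; _⊔_)
open import Data.Integer as ℤ using (ℤ; +_; -[1+_])
open import Data.Fin using (Fin; toℕ)
open import Data.Fin.Subset using (Subset; _∈_; _∉_; _⊆_; ∣_∣; ⊥; ⁅_⁆; _∪_; _∩_)
import Data.Vec as V
open V using (Vec; []; _∷_; lookup; tabulate)
import Data.List as L
open L using (List)
open import Data.Nat.ListAction using () renaming (sum to listSum)
open import Data.Bool.ListAction using () renaming (any to listAny; all to listAll)
open import Data.Product using (∃; _×_)
open import Relation.Nullary.Decidable using (⌊_⌋)
open import Relation.Nullary using (¬_)
open import Relation.Binary.PropositionalEquality using (_≡_)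

allVecs : ∀ {A : Set} (m : ℕ) → List A → List (Vec A m)
allVecs zero    xs = [] L.∷ L.[]
allVecs (suc m) xs = L.concatMap (λ a → L.map (a ∷_) (allVecs m xs)) xs

allSubsets : (m : ℕ) → List (Subset m)
allSubsets m = allVecs m (false L.∷ true L.∷ L.[])

countᵇ : ∀ {A : Set} → (A → Bool) → List A → ℕ
countᵇ P xs = listSum (L.map (λ a → if P a then 1 else 0) xs)

anyFin : ∀ {p} → (Fin p → Bool) → Bool
anyFin {p} P = listAny P (L.allFin p)

allFin : ∀ {p} → (Fin p → Bool) → Bool
allFin {p} P = listAll P (L.allFin p)

_⊆ᵇ_ : ∀ {m} → Subset m → Subset m → Bool
[] ⊆ᵇ [] = true
(a ∷ A) ⊆ᵇ (b ∷ B) = (not a ∨ b) ∧ (A ⊆ᵇ B)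

_≡Sᵇ_ : ∀ {m} → Subset m → Subset m → Bool
A ≡Sᵇ B = (A ⊆ᵇ B) ∧ (B ⊆ᵇ A)

record Matroid (n : ℕ) : Set where
  field
    indep          : Subset n → Bool
    indep-empty    : T (indep ⊥)
    indep-down     : ∀ {A B} → A ⊆ B → T (indep B) → T (indep A)
    indep-exchange : ∀ {A B} → T (indep A) → T (indep B) → ∣ A ∣ < ∣ B ∣ →
                     ∃ λ x → x ∈ B × x ∉ A × T (indep (⁅ x ⁆ ∪ A))
open Matroid public

rank : ∀ {n} → Matroid n → Subset n → ℕ
rank {n} M A =
  L.foldr _⊔_ 0
    (L.map (λ I → if (I ⊆ᵇ A) ∧ indep M I then ∣ I ∣ else 0) (allSubsets n))

-- Polynomials in x_1..x_n, as coefficient functions on exponent vectors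
-- (all polynomials occurring here have coefficients in ℕ ⊆ ℝ).

Poly : ℕ → Set
Poly n = Vec ℕ n → ℕ

belowVecs : ∀ {n} → Vec ℕ n → List (Vec ℕ n)
belowVecs []      = [] L.∷ L.[]
belowVecs (a ∷ α) = L.concatMap (λ b → L.map (b ∷_) (belowVecs α)) (L.upTo (suc a))

_·P_ : ∀ {n} → Poly n → Poly n → Poly n
(F ·P G) α = listSum (L.map (λ β → F β ℕ.* G (V.zipWith _∸_ α β)) (belowVecs α))

oneP : ∀ {n} → Poly n
oneP α = if V.foldr′ (λ a b → (a ≡ᵇ 0) ∧ b) true α then 1 else 0

prodP : ∀ {n p} → Vec (Poly n) p → Poly n
prodP = V.foldr′ _·P_ oneP

_≥P_ : ∀ {n} → Poly n → Poly n → Set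
F ≥P G = ∀ α → G α ≤ F α

-- f_j(M) = Σ_{I independent, |I| = j} Π_{i∈I} x_i ; f_j = 0 for j < 0
fpoly : ∀ {n} → ℤ → Matroid n → Poly n
fpoly (+ j)    M α =
  if V.foldr′ (λ a b → (a <ᵇ 2) ∧ b) true α
     ∧ indep M (V.map (λ a → not (a ≡ᵇ 0)) α)
     ∧ (∣ V.map (λ a → not (a ≡ᵇ 0)) α ∣ ≡ᵇ j)
  then 1 else 0
fpoly -[1+ _ ] M α = 0

-- Set systems on the universe Fin n × Fin c (element (x , j) = copy x^(j)),
-- a subset being encoded as a Vec (Subset c) n (row x = copies of x present).

USub : ℕ → ℕ → Set
USub n c = Vec (Subset c) n

allUSub : (n c : ℕ) → List (USub n c)
allUSub n c = allVecs n (allSubsets c)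

_∪U_ : ∀ {n c} → USub n c → USub n c → USub n c
_∪U_ = V.zipWith _∪_

_∩U_ : ∀ {n c} → USub n c → USub n c → USub n c
_∩U_ = V.zipWith _∩_

_⊆Uᵇ_ : ∀ {n c} → USub n c → USub n c → Bool
A ⊆Uᵇ B = V.foldr′ _∧_ true (V.zipWith _⊆ᵇ_ A B)

_≡Uᵇ_ : ∀ {n c} → USub n c → USub n c → Bool
A ≡Uᵇ B = (A ⊆Uᵇ B) ∧ (B ⊆Uᵇ A)

emptyU : ∀ {n c} → USub n c
emptyU = V.replicate _ ⊥

cardU : ∀ {n c} → USub n c → ℕ
cardU A = V.sum (V.map ∣_∣ A)

record SetSystem (n c : ℕ) : Set where
  field
    ground : USub n c
    indepN : USub n c → Bool
open SetSystem public

module _ {n p : ℕ} (M : Matroid n) (X : Vec (Subset n) p) where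

  isLast : Fin p → Bool
  isLast i = suc (toℕ i) ≡ᵇ p

  lastBlock : Subset n
  lastBlock = tabulate λ x → anyFin λ i → isLast i ∧ lookup (lookup X i) x

  unionX : Subset n
  unionX = V.foldr′ _∪_ ⊥ X

  indep₁ : Subset n → Bool
  indep₁ A = (A ⊆ᵇ unionX) ∧ indep M A

  -- stage 2: M(X_1 ∪ ... ∪ X_p) ⊙ X_1^{q_1} ⋯ ⊙ X_{p-1}^{q_{p-1}}
  -- (q i is the multiplicity of the block i, used for non-last i only;
  --  copies are indexed by Fin c, with c ≥ 1 and c ≥ all the q i)
  module _ (c : ℕ) (q : Fin p → ℕ) where

    ground₂ : USub n c
    ground₂ = tabulate λ x → tabulate λ j →
      lookup unionX x ∧
      ((toℕ j ≡ᵇ 0) ∨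
       (anyFin λ i → not (isLast i) ∧ lookup (lookup X i) x ∧ (toℕ j <ᵇ q i)))

    proj : USub n c → Subset n
    proj S = V.map (λ row → not (∣ row ∣ ≡ᵇ 0)) S

    noTwoCopies : USub n c → Bool
    noTwoCopies S = V.foldr′ (λ row b → (∣ row ∣ <ᵇ 2) ∧ b) true S

    indep₂ : USub n c → Bool
    indep₂ S = (S ⊆Uᵇ ground₂) ∧ noTwoCopies S ∧ indep₁ (proj S)

    -- stage 3: contraction of X_p (the elements x = x^(0), x ∈ X_p)
    contrSet : USub n c
    contrSet = tabulate λ x → tabulate λ j → lookup lastBlock x ∧ (toℕ j ≡ᵇ 0)

    ground₃ : USub n c
    ground₃ = tabulate λ x → tabulate λ j →
      lookup (lookup ground₂ x) j ∧ not (lookup (lookup contrSet x) j)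

    isBasisC : USub n c → Bool
    isBasisC B = (B ⊆Uᵇ contrSet) ∧ indep₂ B ∧
      listAll (λ B' → not ((B ⊆Uᵇ B') ∧ (B' ⊆Uᵇ contrSet) ∧ indep₂ B') ∨ (B ≡Uᵇ B'))
            (allUSub n c)

    indep₃ : USub n c → Bool
    indep₃ S = (S ⊆Uᵇ ground₃) ∧
      listAny (λ B → isBasisC B ∧ indep₂ (S ∪U B)) (allUSub n c)

    MXq : SetSystem n c
    MXq = record { ground = ground₃ ; indepN = indep₃ }

-- q = (1, 2, ..., p-1): block i (0-indexed) gets i+1 copies; copies in Fin p
qStd : ∀ {p} → Fin p → ℕ
qStd i = suc (toℕ i)

MXstd : ∀ {n p} → Matroid n → Vec (Subset n) p → SetSystem n p
MXstd {n} {p} M X = MXq M X p qStd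

size : ∀ {n c} → SetSystem n c → ℕ
size N = cardU (ground N)

depth : ∀ {n p} → Matroid n → Vec (Subset n) p → ℕ
depth M X = rank M (lastBlock M X)

-- π_i(N): ordered set partitions (A_1,…,A_p) of the ground set of N into
-- independent blocks with |A_s| = i_s

isOrderedPartition : ∀ {n c p} → USub n c → Vec (USub n c) p → Bool
isOrderedPartition {p = p} Y A =
  allFin (λ s → allFin (λ t →
    (toℕ s ≡ᵇ toℕ t) ∨ (((lookup A s) ∩U (lookup A t)) ≡Uᵇ emptyU)))
  ∧ (V.foldr′ _∪U_ emptyU A ≡Uᵇ Y)

piCount : ∀ {n c p} → Vec ℤ p → SetSystem n c → ℕ
piCount {n} {c} {p} is N =
  countᵇ (λ A → isOrderedPartition (ground N) A ∧
                allFin (λ s → indepN N (lookup A s) ∧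
                              ⌊ + cardU (lookup A s) ℤ.≟ lookup is s ⌋))
         (allVecs p (allUSub n c))

sumℤ : ∀ {p} → Vec ℤ p → ℤ
sumℤ = V.foldr′ ℤ._+_ (+ 0)

PairwiseDisjoint : ∀ {n p} → Vec (Subset n) p → Set
PairwiseDisjoint {n} {p} X =
  ∀ (i j : Fin p) (x : Fin n) → ¬ (i ≡ j) → x ∈ lookup X i → x ∉ lookup X j

{-# OPTIONS --safe #-}
-- The coefficient of x^α in f_{l+m₁}(M) ⋯ f_{l+m_p}(M) counts p-tuples (I₁, …, I_p) of independent
-- sets with |I_s| = l + m_s and Σ_s χ(I_s) = α; in particular it vanishes unless α ≤ p.
--
-- Fix disjoint X₁, …, X_p, a basis B of X_p and k = l - |B|, and let g_x be the set of copies of x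
-- in the ground set of N = M[X, (1, …, p-1)].  At β = (|g_x|)_x + p·χ(B) every counted tuple contains
-- B in all p blocks; removing B leaves blocks that are independent in M / X_p, each x lying in
-- exactly |g_x| of them.  Handing the |g_x| copies of x to these blocks, in |g_x|! ways, turns such
-- tuples into the ordered partitions counted by π_{k+m}(N), so
--   π_{k+m}(N) = W · [x^β] ∏_s f_{l+m_s}(M),   W = ∏_x |g_x|! > 0,
-- which gives the forward implication.  Conversely, if the coefficient of x^α on the right-hand side
-- is nonzero, X_i = {x : α_x = i} has β = α, and X_p lies in every block of a witnessing tuple, so it
-- is independent and is its own basis; the size and depth conditions follow by counting.
module Submission where

open import Defs

-- Anonymous, so that the ℕ operators opened here stay out of scope of the ℤ statement at the end.
module _ where
  open import Data.Bool using (Bool; true; false; _∧_; _∨_; not; if_then_else_; T) renaming (_≟_ to _≟ᴮ_)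
  open import Data.Bool.Properties using (T-∧; T-∨; T-≡; ∧-zeroʳ; ∧-assoc)
  open import Data.Nat as ℕ
    using (ℕ; zero; suc; _+_; _*_; _≤_; _<_; _∸_; z≤n; s≤s; _⊔_; NonZero; >-nonZero; _≡ᵇ_; _<ᵇ_; _≤ᵇ_; _!)
  open import Data.Nat.Properties
  open import Data.Nat.Tactic.RingSolver using (solve-∀)
  open import Data.Integer as ℤ using (ℤ; -[1+_])
  import Data.Integer.Properties as ℤP
  import Data.Integer.Tactic.RingSolver as ℤRing
  open import Data.Fin using (Fin; toℕ; fromℕ; fromℕ<) renaming (zero to fz; suc to fs)
  open import Data.Fin.Properties using (toℕ-injective; toℕ-fromℕ; toℕ-fromℕ<) renaming (suc-injective to fs-injective)
  open import Data.Fin.Subset using (Subset; _∈_; _∉_; _⊆_; ∣_∣; ⊥; ⁅_⁆; _∪_; _∩_)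
  open import Data.Fin.Subset.Properties
    using (p⊂q⇒∣p∣<∣q∣; x∈p∪q⁺; x∈p∪q⁻; x∈⁅x⁆; x∈⁅y⁆⇒x≡y; ∉⊥; ∣⊥∣≡0; q⊆p∪q; ∣p∣≤∣p∪q∣; ∣p∣≤n; _∈?_;
           ∪-identityʳ)
  import Data.Vec as V
  open V using (Vec; []; _∷_; lookup; tabulate; here; there)
  open import Data.Vec.Properties
    using (lookup∘tabulate; tabulate∘lookup; tabulate-cong; lookup-map; lookup-zipWith; lookup-replicate; []=⇒lookup; lookup⇒[]=)
  import Data.Vec.Properties as VP
  import Data.List as L
  open L using (List)
  import Data.List.Membership.Propositional as LM
  open import Data.List.Membership.Propositional.Properties using (∈-map⁺; ∈-map⁻; ∈-concatMap⁺; ∈-allFin)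
  open import Data.List.Relation.Unary.Any using (here; there)
  open import Data.Nat.ListAction using () renaming (sum to listSum)
  open import Data.Bool.ListAction using () renaming (any to listAny; all to listAll)
  open import Data.Product using (∃; _×_; _,_; proj₁; proj₂)
  open import Data.Sum using (_⊎_; inj₁; inj₂)
  open import Data.Empty using (⊥-elim) renaming (⊥ to Empty)
  open import Relation.Binary.PropositionalEquality
  open import Relation.Nullary using (¬_; yes; no)
  open import Relation.Nullary.Decidable using (⌊_⌋; toWitness; fromWitness)
  open import Function.Bundles using (Equivalence)

  𝟙 : Bool → ℕ
  𝟙 b = if b then 1 else 0

  𝟙-∧ : ∀ a b → 𝟙 (a ∧ b) ≡ 𝟙 a * 𝟙 b
  𝟙-∧ false b = refl
  𝟙-∧ true  b = sym (+-identityʳ _)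

  T⇒𝟙≡1 : ∀ {b} → T b → 𝟙 b ≡ 1
  T⇒𝟙≡1 {true} _ = refl

  T⇒≡true : ∀ {a} → T a → a ≡ true
  T⇒≡true = Equivalence.to T-≡

  ≡true⇒T : ∀ {a} → a ≡ true → T a
  ≡true⇒T = Equivalence.from T-≡

  ¬T⇒≡false : ∀ {a} → ¬ T a → a ≡ false
  ¬T⇒≡false {false} _ = refl
  ¬T⇒≡false {true}  f = ⊥-elim (f _)

  T-ext : ∀ {a b} → (T a → T b) → (T b → T a) → a ≡ b
  T-ext {false} {false} f g = refl
  T-ext {false} {true}  f g = ⊥-elim (g _)
  T-ext {true}  {false} f g = ⊥-elim (f _)
  T-ext {true}  {true}  f g = refl

  T-∧⁺ : ∀ {a b} → T a → T b → T (a ∧ b)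
  T-∧⁺ ta tb = Equivalence.from T-∧ (ta , tb)

  T-∧ˡ : ∀ {a b} → T (a ∧ b) → T a
  T-∧ˡ t = proj₁ (Equivalence.to T-∧ t)

  T-∧ʳ : ∀ {a b} → T (a ∧ b) → T b
  T-∧ʳ {a} t = proj₂ (Equivalence.to (T-∧ {a}) t)

  T-∨⁻ : ∀ {a b} → T (a ∨ b) → T a ⊎ T b
  T-∨⁻ = Equivalence.to T-∨

  T-∨ˡ : ∀ {a b} → T a → T (a ∨ b)
  T-∨ˡ t = Equivalence.from T-∨ (inj₁ t)

  T-∨ʳ : ∀ {a b} → T b → T (a ∨ b)
  T-∨ʳ {a} t = Equivalence.from (T-∨ {a}) (inj₂ t)

  T-not⁻ : ∀ {a} → T (not a) → ¬ T a
  T-not⁻ {false} _ ()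

  T-not⁺ : ∀ {a} → ¬ T a → T (not a)
  T-not⁺ {false} _ = _
  T-not⁺ {true}  f = f _

  ∧-interchange : ∀ a b c d → ((a ∧ b) ∧ (c ∧ d)) ≡ ((a ∧ c) ∧ (b ∧ d))
  ∧-interchange false b c d = refl
  ∧-interchange true  false false d = refl
  ∧-interchange true  false true  d = refl
  ∧-interchange true  true  c     d = refl

  ∑ : ∀ {A : Set} → List A → (A → ℕ) → ℕ
  ∑ xs f = listSum (L.map f xs)

  module _ {A : Set} where
    ∑-++ : (xs ys : List A) (f : A → ℕ) → ∑ (xs L.++ ys) f ≡ ∑ xs f + ∑ ys f
    ∑-++ L.[]       ys f = refl
    ∑-++ (x L.∷ xs) ys f rewrite ∑-++ xs ys f = sym (+-assoc (f x) _ _)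

    ∑-cong : (xs : List A) {f g : A → ℕ} → (∀ a → f a ≡ g a) → ∑ xs f ≡ ∑ xs g
    ∑-cong L.[]       e = refl
    ∑-cong (x L.∷ xs) e = cong₂ _+_ (e x) (∑-cong xs e)

    ∑-zero : (xs : List A) {f : A → ℕ} → (∀ a → f a ≡ 0) → ∑ xs f ≡ 0
    ∑-zero L.[]       e = refl
    ∑-zero (x L.∷ xs) e rewrite e x = ∑-zero xs e

    ∑-+ : (xs : List A) (f g : A → ℕ) → ∑ xs (λ a → f a + g a) ≡ ∑ xs f + ∑ xs g
    ∑-+ L.[]       f g = refl
    ∑-+ (x L.∷ xs) f g rewrite ∑-+ xs f g = interchange (f x) (g x) (∑ xs f) (∑ xs g)
      where
      interchange : ∀ a b c d → a + b + (c + d) ≡ a + c + (b + d)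
      interchange = solve-∀

    ∑-*ˡ : (xs : List A) (c : ℕ) (f : A → ℕ) → ∑ xs (λ a → c * f a) ≡ c * ∑ xs f
    ∑-*ˡ L.[]       c f = sym (*-zeroʳ c)
    ∑-*ˡ (x L.∷ xs) c f rewrite ∑-*ˡ xs c f = sym (*-distribˡ-+ c (f x) _)

    ∑-*ʳ : (xs : List A) (c : ℕ) (f : A → ℕ) → ∑ xs (λ a → f a * c) ≡ ∑ xs f * c
    ∑-*ʳ xs c f = trans (∑-cong xs (λ a → *-comm (f a) c)) (trans (∑-*ˡ xs c f) (*-comm c _))

    ∑𝟙≢0⇒∃ : (xs : List A) (b : A → Bool) → ¬ ∑ xs (λ a → 𝟙 (b a)) ≡ 0 → ∃ λ a → T (b a)
    ∑𝟙≢0⇒∃ L.[]       b nz = ⊥-elim (nz refl)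
    ∑𝟙≢0⇒∃ (x L.∷ xs) b nz with b x in e
    ... | true  = x , ≡true⇒T e
    ... | false = ∑𝟙≢0⇒∃ xs b nz

  module _ {A B : Set} where
    ∑-map : (xs : List A) (g : A → B) (f : B → ℕ) → ∑ (L.map g xs) f ≡ ∑ xs (λ a → f (g a))
    ∑-map L.[]       g f = refl
    ∑-map (x L.∷ xs) g f = cong (f (g x) +_) (∑-map xs g f)

    ∑-concatMap : (xs : List A) (g : A → List B) (f : B → ℕ) →
      ∑ (L.concatMap g xs) f ≡ ∑ xs (λ a → ∑ (g a) f)
    ∑-concatMap L.[]       g f = refl
    ∑-concatMap (x L.∷ xs) g f = trans (∑-++ (g x) _ f) (cong (∑ (g x) f +_) (∑-concatMap xs g f))

    ∑-comm : (xs : List A) (ys : List B) (f : A → B → ℕ) →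
      ∑ xs (λ a → ∑ ys (λ b → f a b)) ≡ ∑ ys (λ b → ∑ xs (λ a → f a b))
    ∑-comm L.[]       ys f = sym (∑-zero ys (λ _ → refl))
    ∑-comm (x L.∷ xs) ys f =
      trans (cong (∑ ys (f x) +_) (∑-comm xs ys f)) (sym (∑-+ ys (f x) (λ b → ∑ xs (λ a → f a b))))

  ∑-allVecs-suc : ∀ {A : Set} (m : ℕ) (xs : List A) (f : Vec A (suc m) → ℕ) →
    ∑ (allVecs (suc m) xs) f ≡ ∑ xs (λ a → ∑ (allVecs m xs) (λ v → f (a ∷ v)))
  ∑-allVecs-suc m xs f =
    trans (∑-concatMap xs (λ a → L.map (a ∷_) (allVecs m xs)) f)
          (∑-cong xs (λ a → ∑-map (allVecs m xs) (a ∷_) f))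

  ∑-allVecs-singleton : ∀ {A : Set} (a : A) p (h : Vec A p → ℕ) →
    ∑ (allVecs p (a L.∷ L.[])) h ≡ h (V.replicate p a)
  ∑-allVecs-singleton a zero    h = +-identityʳ _
  ∑-allVecs-singleton a (suc p) h =
    trans (∑-allVecs-suc p _ h) (trans (+-identityʳ _) (∑-allVecs-singleton a p (λ v → h (a ∷ v))))

  -- Every element occurs exactly once in xs, phrased as: summing a point mass over xs evaluates it.
  Enumerates : ∀ {A : Set} → List A → Set
  Enumerates {A} xs = ∀ (b : A) (f : A → ℕ) → (∀ a → ¬ a ≡ b → f a ≡ 0) → ∑ xs f ≡ f b

  enumerates-bools : Enumerates (false L.∷ true L.∷ L.[])
  enumerates-bools false f e rewrite e true (λ ()) = +-identityʳ _
  enumerates-bools true  f e rewrite e false (λ ()) = +-identityʳ _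

  enumerates-allVecs : ∀ {A : Set} {xs : List A} → Enumerates xs → (m : ℕ) → Enumerates (allVecs m xs)
  enumerates-allVecs ex zero [] f e = +-identityʳ _
  enumerates-allVecs {xs = xs} ex (suc m) (b ∷ bs) f e =
    trans (∑-allVecs-suc m xs f)
     (trans (ex b _ (λ a a≢b → ∑-zero (allVecs m xs) (λ v → e (a ∷ v) (λ q → a≢b (cong V.head q)))))
            (enumerates-allVecs ex m bs (λ v → f (b ∷ v)) (λ v v≢ → e (b ∷ v) (λ q → v≢ (cong V.tail q)))))

  enumerates-allSubsets : ∀ n → Enumerates (allSubsets n)
  enumerates-allSubsets = enumerates-allVecs enumerates-bools

  ∈-allVecs : ∀ {A : Set} {xs : List A} → (∀ a → a LM.∈ xs) → ∀ {m} (v : Vec A m) → v LM.∈ allVecs m xs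
  ∈-allVecs c [] = here refl
  ∈-allVecs {xs = xs} c (a ∷ v) =
    ∈-concatMap⁺ (λ b → L.map (b ∷_) (allVecs _ xs)) (LM.lose (c a) (∈-map⁺ (a ∷_) (∈-allVecs c v)))

  ∈-bools : ∀ b → b LM.∈ (false L.∷ true L.∷ L.[])
  ∈-bools false = here refl
  ∈-bools true  = there (here refl)

  ∈-allSubsets : ∀ {n} (S : Subset n) → S LM.∈ allSubsets n
  ∈-allSubsets = ∈-allVecs ∈-bools

  ∏ : ∀ {n} → (Fin n → ℕ) → ℕ
  ∏ {zero}  h = 1
  ∏ {suc n} h = h fz * ∏ (λ i → h (fs i))

  ∏-cong : ∀ {m} {f g : Fin m → ℕ} → (∀ x → f x ≡ g x) → ∏ f ≡ ∏ g
  ∏-cong {zero}  e = refl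
  ∏-cong {suc m} e = cong₂ _*_ (e fz) (∏-cong (λ x → e (fs x)))

  ∏-* : ∀ {m} (f g : Fin m → ℕ) → ∏ (λ x → f x * g x) ≡ ∏ f * ∏ g
  ∏-* {zero}  f g = refl
  ∏-* {suc m} f g rewrite ∏-* (λ x → f (fs x)) (λ x → g (fs x)) = interchange (f fz) (g fz) _ _
    where
    interchange : ∀ a b c d → a * b * (c * d) ≡ a * c * (b * d)
    interchange = solve-∀

  ∏-nonZero : ∀ {m} (f : Fin m → ℕ) → (∀ x → NonZero (f x)) → NonZero (∏ f)
  ∏-nonZero {zero}  f h = _
  ∏-nonZero {suc m} f h = m*n≢0 (f fz) _ {{h fz}} {{∏-nonZero (λ x → f (fs x)) (λ x → h (fs x))}}

  ∑-allVecs-∏ : ∀ {A : Set} (xs : List A) (n : ℕ) (h : Fin n → A → ℕ) →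
    ∑ (allVecs n xs) (λ v → ∏ (λ x → h x (lookup v x))) ≡ ∏ (λ x → ∑ xs (h x))
  ∑-allVecs-∏ xs zero    h = refl
  ∑-allVecs-∏ xs (suc n) h =
    trans (∑-allVecs-suc n xs _)
     (trans (∑-cong xs (λ a → ∑-*ˡ (allVecs n xs) (h fz a) _))
      (trans (∑-cong xs (λ a → cong (h fz a *_) (∑-allVecs-∏ xs n (λ x → h (fs x)))))
        (∑-*ʳ xs _ (h fz))))

  module _ {A : Set} (P : A → Bool) where
    any-sound : ∀ xs → T (listAny P xs) → ∃ λ a → a LM.∈ xs × T (P a)
    any-sound (x L.∷ xs) t with P x in e
    ... | true  = x , here refl , ≡true⇒T e
    ... | false with any-sound xs t
    ...   | a , m , pa = a , there m , pa

    any-complete : ∀ xs {a} → a LM.∈ xs → T (P a) → T (listAny P xs)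
    any-complete (x L.∷ xs) (here refl) pa with P x
    ... | true = _
    any-complete (x L.∷ xs) (there m) pa with P x
    ... | true  = _
    ... | false = any-complete xs m pa

    all-sound : ∀ xs {a} → T (listAll P xs) → a LM.∈ xs → T (P a)
    all-sound (x L.∷ xs) t (here refl) = T-∧ˡ t
    all-sound (x L.∷ xs) t (there m)   = all-sound xs (T-∧ʳ {P x} t) m

    all-complete : ∀ xs → (∀ a → a LM.∈ xs → T (P a)) → T (listAll P xs)
    all-complete L.[]       f = _
    all-complete (x L.∷ xs) f = T-∧⁺ (f x (here refl)) (all-complete xs (λ a m → f a (there m)))

  anyFin-sound : ∀ {p} (P : Fin p → Bool) → T (anyFin P) → ∃ λ i → T (P i)
  anyFin-sound {p} P t with any-sound P (L.allFin p) t
  ... | i , _ , pi = i , pi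

  anyFin-complete : ∀ {p} (P : Fin p → Bool) i → T (P i) → T (anyFin P)
  anyFin-complete P i pi = any-complete P _ (∈-allFin i) pi

  allFin-sound : ∀ {p} (P : Fin p → Bool) → T (allFin P) → ∀ i → T (P i)
  allFin-sound P t i = all-sound P _ t (∈-allFin i)

  allFin-complete : ∀ {p} (P : Fin p → Bool) → (∀ i → T (P i)) → T (allFin P)
  allFin-complete {p} P f = all-complete P (L.allFin p) (λ a _ → f a)

  allFin-cong : ∀ {m} {P Q : Fin m → Bool} → (∀ i → P i ≡ Q i) → allFin P ≡ allFin Q
  allFin-cong {P = P} {Q} e =
    T-ext (λ t → allFin-complete Q (λ i → subst T (e i) (allFin-sound P t i)))
          (λ t → allFin-complete P (λ i → subst T (sym (e i)) (allFin-sound Q t i)))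

  𝟙-allFin : ∀ {p} (P : Fin p → Bool) → 𝟙 (allFin P) ≡ ∏ (λ i → 𝟙 (P i))
  𝟙-allFin {zero}  P = refl
  𝟙-allFin {suc p} P = trans (cong 𝟙 split) (trans (𝟙-∧ (P fz) _) (cong (𝟙 (P fz) *_) (𝟙-allFin (λ i → P (fs i)))))
    where
    split : allFin P ≡ (P fz ∧ allFin (λ i → P (fs i)))
    split = T-ext
      (λ t → T-∧⁺ (allFin-sound P t fz) (allFin-complete (λ i → P (fs i)) (λ i → allFin-sound P t (fs i))))
      (λ t → allFin-complete P λ { fz → T-∧ˡ t ; (fs i) → allFin-sound (λ i → P (fs i)) (T-∧ʳ {P fz} t) i })

  vec-ext : ∀ {A : Set} {n} {u v : Vec A n} → (∀ i → lookup u i ≡ lookup v i) → u ≡ v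
  vec-ext {u = u} {v} e = trans (sym (tabulate∘lookup u)) (trans (tabulate-cong e) (tabulate∘lookup v))

  all<2ᵇ-sound : ∀ {A : Set} {m} (f : A → ℕ) (v : Vec A m) →
    T (V.foldr′ (λ a b → (f a <ᵇ 2) ∧ b) true v) → ∀ x → T (f (lookup v x) <ᵇ 2)
  all<2ᵇ-sound f (a ∷ v) t fz     = T-∧ˡ t
  all<2ᵇ-sound f (a ∷ v) t (fs x) = all<2ᵇ-sound f v (T-∧ʳ {f a <ᵇ 2} t) x

  all<2ᵇ-complete : ∀ {A : Set} {m} (f : A → ℕ) (v : Vec A m) →
    (∀ x → T (f (lookup v x) <ᵇ 2)) → T (V.foldr′ (λ a b → (f a <ᵇ 2) ∧ b) true v)
  all<2ᵇ-complete f []      h = _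
  all<2ᵇ-complete f (a ∷ v) h = T-∧⁺ (h fz) (all<2ᵇ-complete f v (λ x → h (fs x)))

  ∈⇒T : ∀ {n} {x : Fin n} {S : Subset n} → x ∈ S → T (lookup S x)
  ∈⇒T m = ≡true⇒T ([]=⇒lookup m)

  T⇒∈ : ∀ {n} {x : Fin n} {S : Subset n} → T (lookup S x) → x ∈ S
  T⇒∈ {x = x} {S} t = lookup⇒[]= x S (T⇒≡true t)

  ⊆ᵇ-sound : ∀ {q} (A B : Subset q) → T (A ⊆ᵇ B) → ∀ j → T (lookup A j) → T (lookup B j)
  ⊆ᵇ-sound (true ∷ A) (true ∷ B) t fz     a = _
  ⊆ᵇ-sound (a ∷ A)    (b ∷ B)    t (fs j) x = ⊆ᵇ-sound A B (T-∧ʳ {not a ∨ b} t) j x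

  ⊆ᵇ-complete : ∀ {q} (A B : Subset q) → (∀ j → T (lookup A j) → T (lookup B j)) → T (A ⊆ᵇ B)
  ⊆ᵇ-complete []          []      f = _
  ⊆ᵇ-complete (false ∷ A) (b ∷ B) f = ⊆ᵇ-complete A B (λ j → f (fs j))
  ⊆ᵇ-complete (true ∷ A)  (b ∷ B) f with f fz _
  ⊆ᵇ-complete (true ∷ A)  (true ∷ B) f | _ = ⊆ᵇ-complete A B (λ j → f (fs j))

  lookup-⊥ : ∀ {q} (j : Fin q) → lookup ⊥ j ≡ false
  lookup-⊥ j = lookup-replicate j false

  ∣p∣≡0⇒p≡⊥ : ∀ {q} (r : Subset q) → ∣ r ∣ ≡ 0 → r ≡ ⊥
  ∣p∣≡0⇒p≡⊥ []          e = refl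
  ∣p∣≡0⇒p≡⊥ (false ∷ r) e = cong (false ∷_) (∣p∣≡0⇒p≡⊥ r e)

  ∣p∣≡0⇒∉ : ∀ {q} (r : Subset q) j → ∣ r ∣ ≡ 0 → ¬ T (lookup r j)
  ∣p∣≡0⇒∉ r j e x rewrite ∣p∣≡0⇒p≡⊥ r e | lookup-⊥ {_} j = x

  ∉⇒∣p∣≡0 : ∀ {q} (r : Subset q) → (∀ j → ¬ T (lookup r j)) → ∣ r ∣ ≡ 0
  ∉⇒∣p∣≡0 []          f = refl
  ∉⇒∣p∣≡0 (false ∷ r) f = ∉⇒∣p∣≡0 r (λ j → f (fs j))
  ∉⇒∣p∣≡0 (true ∷ r)  f = ⊥-elim (f fz _)

  ∣p∣≢0⇒∈ : ∀ {q} (r : Subset q) → T (not (∣ r ∣ ≡ᵇ 0)) → ∃ λ j → T (lookup r j)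
  ∣p∣≢0⇒∈ (true ∷ r)  t = fz , _
  ∣p∣≢0⇒∈ (false ∷ r) t with ∣p∣≢0⇒∈ r t
  ... | j , u = fs j , u

  ∈⇒∣p∣≢0 : ∀ {q} (r : Subset q) j → T (lookup r j) → T (not (∣ r ∣ ≡ᵇ 0))
  ∈⇒∣p∣≢0 r j u = T-not⁺ (λ z → ∣p∣≡0⇒∉ r j (≡ᵇ⇒≡ _ _ z) u)

  ∉⇒∣p∣<n : ∀ {q} (r : Subset q) t → ¬ T (lookup r t) → ∣ r ∣ < q
  ∉⇒∣p∣<n (false ∷ r) fz     nt = s≤s (∣p∣≤n r)
  ∉⇒∣p∣<n (true ∷ r)  fz     nt = ⊥-elim (nt _)
  ∉⇒∣p∣<n (false ∷ r) (fs t) nt = m≤n⇒m≤1+n (∉⇒∣p∣<n r t nt)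
  ∉⇒∣p∣<n (true ∷ r)  (fs t) nt = s≤s (∉⇒∣p∣<n r t nt)

  ∣p∣≡n⇒∈ : ∀ {q} (r : Subset q) t → ∣ r ∣ ≡ q → T (lookup r t)
  ∣p∣≡n⇒∈ r t e with lookup r t in eq
  ... | true  = _
  ... | false = ⊥-elim (<⇒≢ (∉⇒∣p∣<n r t (λ u → subst T eq u)) e)

  ∣initial-segment∣ : ∀ {q} (r : Subset q) s → s ≤ q →
    (∀ j → T (lookup r j) → toℕ j < s) → (∀ j → toℕ j < s → T (lookup r j)) → ∣ r ∣ ≡ s
  ∣initial-segment∣ []          zero    le f g = refl
  ∣initial-segment∣ (false ∷ r) zero    le f g =
    ∣initial-segment∣ r zero z≤n (λ j u → ⊥-elim (n≮0 (f (fs j) u))) (λ j ())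
  ∣initial-segment∣ (true ∷ r)  zero    le f g = ⊥-elim (n≮0 (f fz _))
  ∣initial-segment∣ (false ∷ r) (suc s) le f g = ⊥-elim (g fz (s≤s z≤n))
  ∣initial-segment∣ (true ∷ r)  (suc s) (s≤s le) f g =
    cong suc (∣initial-segment∣ r s le (λ j u → ≤-pred (f (fs j) u)) (λ j lt → g (fs j) (s≤s lt)))

  ⊆⁅0⁆⇒∣p∣<2 : ∀ {q} (r : Subset q) → (∀ j → T (lookup r j) → toℕ j ≡ 0) → T (∣ r ∣ <ᵇ 2)
  ⊆⁅0⁆⇒∣p∣<2 []          f = _
  ⊆⁅0⁆⇒∣p∣<2 (false ∷ r) f rewrite ∉⇒∣p∣≡0 r (λ j u → 0≢1+n (sym (f (fs j) u))) = _
  ⊆⁅0⁆⇒∣p∣<2 (true ∷ r)  f rewrite ∉⇒∣p∣≡0 r (λ j u → 0≢1+n (sym (f (fs j) u))) = _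

  <ᵇ2-mono : ∀ a b → a ≤ b → T (b <ᵇ 2) → T (a <ᵇ 2)
  <ᵇ2-mono zero          b             le              t = _
  <ᵇ2-mono (suc zero)    (suc b)       le              t = _
  <ᵇ2-mono (suc (suc a)) (suc (suc b)) (s≤s (s≤s le)) ()

  ∣p∪q∣≡∣p∣+∣q∣ : ∀ {n} (p q : Subset n) → (∀ {x} → x ∈ p → x ∉ q) → ∣ p ∪ q ∣ ≡ ∣ p ∣ + ∣ q ∣
  ∣p∪q∣≡∣p∣+∣q∣ []          []          d = refl
  ∣p∪q∣≡∣p∣+∣q∣ (true ∷ p)  (true ∷ q)  d = ⊥-elim (d here here)
  ∣p∪q∣≡∣p∣+∣q∣ (true ∷ p)  (false ∷ q) d = cong suc (∣p∪q∣≡∣p∣+∣q∣ p q (λ x y → d (there x) (there y)))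
  ∣p∪q∣≡∣p∣+∣q∣ (false ∷ p) (true ∷ q)  d =
    trans (cong suc (∣p∪q∣≡∣p∣+∣q∣ p q (λ x y → d (there x) (there y)))) (sym (+-suc _ _))
  ∣p∪q∣≡∣p∣+∣q∣ (false ∷ p) (false ∷ q) d = ∣p∪q∣≡∣p∣+∣q∣ p q (λ x y → d (there x) (there y))

  lookup-∪ : ∀ {n} (A B : Subset n) x → lookup (A ∪ B) x ≡ (lookup A x ∨ lookup B x)
  lookup-∪ A B x = lookup-zipWith _∨_ x A B

  ⋃-sound : ∀ {n m} (Y : Vec (Subset n) m) x → T (lookup (V.foldr′ _∪_ ⊥ Y) x) → ∃ λ i → T (lookup (lookup Y i) x)
  ⋃-sound []      x t rewrite lookup-⊥ x = ⊥-elim t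
  ⋃-sound (A ∷ Y) x t rewrite lookup-∪ A (V.foldr′ _∪_ ⊥ Y) x with T-∨⁻ {lookup A x} t
  ... | inj₁ a = fz , a
  ... | inj₂ b with ⋃-sound Y x b
  ...   | i , c = fs i , c

  ⋃-complete : ∀ {n m} (Y : Vec (Subset n) m) x i → T (lookup (lookup Y i) x) → T (lookup (V.foldr′ _∪_ ⊥ Y) x)
  ⋃-complete (A ∷ Y) x fz     t rewrite lookup-∪ A (V.foldr′ _∪_ ⊥ Y) x = T-∨ˡ t
  ⋃-complete (A ∷ Y) x (fs i) t rewrite lookup-∪ A (V.foldr′ _∪_ ⊥ Y) x = T-∨ʳ {lookup A x} (⋃-complete Y x i t)

  ≤-foldr⊔ : ∀ {y} (xs : List ℕ) → y LM.∈ xs → y ≤ L.foldr _⊔_ 0 xs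
  ≤-foldr⊔ (x L.∷ xs) (here refl) = m≤m⊔n x _
  ≤-foldr⊔ (x L.∷ xs) (there p)   = ≤-trans (≤-foldr⊔ xs p) (m≤n⊔m x _)

  foldr⊔-attained : ∀ (xs : List ℕ) → L.foldr _⊔_ 0 xs ≡ 0 ⊎ L.foldr _⊔_ 0 xs LM.∈ xs
  foldr⊔-attained L.[]       = inj₁ refl
  foldr⊔-attained (x L.∷ xs) with ⊔-sel x (L.foldr _⊔_ 0 xs)
  ... | inj₁ e = inj₂ (here e)
  ... | inj₂ e with foldr⊔-attained xs
  ...   | inj₁ z = inj₁ (trans e z)
  ...   | inj₂ m = inj₂ (subst (LM._∈ (x L.∷ xs)) (sym e) (there m))

  module Bases {n : ℕ} (M : Matroid n) where
    Independent : Subset n → Set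
    Independent S = T (indep M S)

    IsBasis : Subset n → Subset n → Set
    IsBasis C b = (b ⊆ C) × Independent b × (∀ {x} → x ∈ C → x ∉ b → ¬ Independent (⁅ x ⁆ ∪ b))

    ⁅x⁆∪-strict : ∀ {x} {I : Subset n} → x ∉ I → (I ⊆ (⁅ x ⁆ ∪ I)) × ∃ λ y → y ∈ (⁅ x ⁆ ∪ I) × y ∉ I
    ⁅x⁆∪-strict {x} {I} x∉I = q⊆p∪q ⁅ x ⁆ I , x , x∈p∪q⁺ (inj₁ (x∈⁅x⁆ x)) , x∉I

    ⁅x⁆∪-⊆ : ∀ {x} {I A : Subset n} → x ∈ A → I ⊆ A → (⁅ x ⁆ ∪ I) ⊆ A
    ⁅x⁆∪-⊆ {x} {I} x∈A IA y∈ with x∈p∪q⁻ ⁅ x ⁆ I y∈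
    ... | inj₁ y∈x = subst (_∈ _) (sym (x∈⁅y⁆⇒x≡y x y∈x)) x∈A
    ... | inj₂ y∈I = IA y∈I

    ⁅x⁆∪-mono : ∀ {x} {I K : Subset n} → I ⊆ K → (⁅ x ⁆ ∪ I) ⊆ (⁅ x ⁆ ∪ K)
    ⁅x⁆∪-mono {x} {I} IK y∈ with x∈p∪q⁻ ⁅ x ⁆ I y∈
    ... | inj₁ y∈x = x∈p∪q⁺ (inj₁ y∈x)
    ... | inj₂ y∈I = x∈p∪q⁺ (inj₂ (IK y∈I))

    basis-size-unique : ∀ {C b b'} → IsBasis C b → IsBasis C b' → ∣ b ∣ ≡ ∣ b' ∣
    basis-size-unique B B' = ≤-antisym (≤-basis B' B) (≤-basis B B')
      where
      ≤-basis : ∀ {C b b'} → IsBasis C b → IsBasis C b' → ∣ b' ∣ ≤ ∣ b ∣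
      ≤-basis (bC , ib , mb) (b'C , ib' , _) = ≮⇒≥ λ lt →
        let (x , x∈b' , x∉b , i) = indep-exchange M ib ib' lt in mb (b'C x∈b') x∉b i

    private
      sizes : Subset n → List ℕ
      sizes A = L.map (λ I → if (I ⊆ᵇ A) ∧ indep M I then ∣ I ∣ else 0) (allSubsets n)

      ifᵀ : ∀ {A : Set} {b} {x y : A} → T b → (if b then x else y) ≡ x
      ifᵀ {b = true} _ = refl

    independent⇒∣∣≤rank : ∀ A I → I ⊆ A → Independent I → ∣ I ∣ ≤ rank M A
    independent⇒∣∣≤rank A I I⊆A iI =
      ≤-foldr⊔ (sizes A) (subst (LM._∈ sizes A) listed (∈-map⁺ _ (∈-allSubsets I)))
      where
      listed : (if (I ⊆ᵇ A) ∧ indep M I then ∣ I ∣ else 0) ≡ ∣ I ∣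
      listed = ifᵀ (T-∧⁺ (⊆ᵇ-complete I A (λ j t → ∈⇒T (I⊆A (T⇒∈ t)))) iI)

    rank-attained : ∀ A → ∃ λ I → I ⊆ A × Independent I × ∣ I ∣ ≡ rank M A
    rank-attained A with foldr⊔-attained (sizes A)
    ... | inj₁ z = ⊥ , (λ x → ⊥-elim (∉⊥ x)) , indep-empty M , trans (∣⊥∣≡0 n) (sym z)
    ... | inj₂ m with ∈-map⁻ _ m
    ...   | I , _ , e with I ⊆ᵇ A in eqA | indep M I in eqI
    ...     | true  | true  = I , (λ x∈ → T⇒∈ (⊆ᵇ-sound I A (≡true⇒T eqA) _ (∈⇒T x∈))) , ≡true⇒T eqI , sym e
    ...     | true  | false = ⊥ , (λ x → ⊥-elim (∉⊥ x)) , indep-empty M , trans (∣⊥∣≡0 n) (sym e)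
    ...     | false | _     = ⊥ , (λ x → ⊥-elim (∉⊥ x)) , indep-empty M , trans (∣⊥∣≡0 n) (sym e)

    basis-of-rank : ∀ A → ∃ λ b → IsBasis A b × ∣ b ∣ ≡ rank M A
    basis-of-rank A with rank-attained A
    ... | I , IA , iI , e = I , (IA , iI , λ {x} x∈A x∉I i →
           <⇒≱ (p⊂q⇒∣p∣<∣q∣ (⁅x⁆∪-strict x∉I))
               (subst (_ ≤_) (sym e) (independent⇒∣∣≤rank A _ (⁅x⁆∪-⊆ x∈A IA) i))) , e

    ∣basis∣≡rank : ∀ {A b} → IsBasis A b → ∣ b ∣ ≡ rank M A
    ∣basis∣≡rank {A} B with basis-of-rank A
    ... | b₀ , B₀ , e = trans (basis-size-unique B B₀) e

    -- Grow b' inside J ∪ b' by exchange against J ∪ b: an element offered from b would contradict the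
    -- maximality of b', so the growth only stops at J ∪ b'.
    ∪-basis-swap : ∀ {J C b b'} → (∀ {x} → x ∈ J → x ∉ C) → IsBasis C b → IsBasis C b' →
      Independent (J ∪ b) → Independent (J ∪ b')
    ∪-basis-swap {J} {C} {b} {b'} J∩C≡∅ B@(bC , ib , mb) B'@(b'C , ib' , mb') iJb =
      augment ∣ J ∪ b ∣ b' (m≤m+n _ _) (λ z → z) (q⊆p∪q J b') ib'
      where
      N : ℕ
      N = ∣ J ∪ b ∣
      ∣J∪b'∣≡N : ∣ J ∪ b' ∣ ≡ N
      ∣J∪b'∣≡N = trans (∣p∪q∣≡∣p∣+∣q∣ J b' (λ x∈J x∈b' → J∩C≡∅ x∈J (b'C x∈b')))
                 (trans (cong (∣ J ∣ +_) (basis-size-unique B' B))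
                   (sym (∣p∪q∣≡∣p∣+∣q∣ J b (λ x∈J x∈b → J∩C≡∅ x∈J (bC x∈b)))))
      augment : ∀ f K → N ≤ f + ∣ K ∣ → b' ⊆ K → K ⊆ (J ∪ b') → Independent K → Independent (J ∪ b')
      augment f K le b'K KJ iK with ∣ K ∣ <? N
      augment zero K le b'K KJ iK | yes lt = ⊥-elim (<⇒≱ lt le)
      augment (suc f) K le b'K KJ iK | yes lt with indep-exchange M iK iJb lt
      ... | x , x∈Jb , x∉K , iK' with x∈p∪q⁻ J b x∈Jb
      ...   | inj₂ x∈b = ⊥-elim (mb' (bC x∈b) (λ x∈b' → x∉K (b'K x∈b')) (indep-down M (⁅x⁆∪-mono b'K) iK'))
      ...   | inj₁ x∈J = augment f (⁅ x ⁆ ∪ K)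
               (≤-trans le (subst (_≤ f + ∣ ⁅ x ⁆ ∪ K ∣) (+-suc f _) (+-monoʳ-≤ f (p⊂q⇒∣p∣<∣q∣ (⁅x⁆∪-strict x∉K)))))
               (λ z → q⊆p∪q ⁅ x ⁆ K (b'K z)) (⁅x⁆∪-⊆ (x∈p∪q⁺ (inj₁ x∈J)) KJ) iK'
      augment f K le b'K KJ iK | no ¬lt = indep-down M J∪b'⊆K iK
        where
        J∪b'⊆K : (J ∪ b') ⊆ K
        J∪b'⊆K {y} y∈ with y ∈? K
        ... | yes p = p
        ... | no  p = ⊥-elim (<⇒≱ (p⊂q⇒∣p∣<∣q∣ (KJ , y , y∈ , p)) (subst (_≤ ∣ K ∣) (sym ∣J∪b'∣≡N) (≮⇒≥ ¬lt)))

  -- Coefficients of products of the polynomials f_j(M)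

  χ : ∀ {n} → Subset n → Vec ℕ n
  χ = V.map 𝟙

  _≤ᵥᵇ_ : ∀ {n} → Vec ℕ n → Vec ℕ n → Bool
  []      ≤ᵥᵇ []      = true
  (a ∷ α) ≤ᵥᵇ (b ∷ β) = (a ≤ᵇ b) ∧ (α ≤ᵥᵇ β)

  _≡ᵥᵇ_ : ∀ {n} → Vec ℕ n → Vec ℕ n → Bool
  []      ≡ᵥᵇ []      = true
  (a ∷ α) ≡ᵥᵇ (b ∷ β) = (a ≡ᵇ b) ∧ (α ≡ᵥᵇ β)

  ≡ᵥᵇ-sound : ∀ {m} (u α : Vec ℕ m) → T (u ≡ᵥᵇ α) → ∀ x → lookup u x ≡ lookup α x
  ≡ᵥᵇ-sound (a ∷ u) (b ∷ α) t fz     = ≡ᵇ⇒≡ a b (T-∧ˡ t)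
  ≡ᵥᵇ-sound (a ∷ u) (b ∷ α) t (fs x) = ≡ᵥᵇ-sound u α (T-∧ʳ {a ≡ᵇ b} t) x

  ≡ᵥᵇ-complete : ∀ {m} (u α : Vec ℕ m) → (∀ x → lookup u x ≡ lookup α x) → T (u ≡ᵥᵇ α)
  ≡ᵥᵇ-complete []      []      f = _
  ≡ᵥᵇ-complete (a ∷ u) (b ∷ α) f = T-∧⁺ (≡⇒≡ᵇ a b (f fz)) (≡ᵥᵇ-complete u α (λ x → f (fs x)))

  is01 : ∀ {n} → Vec ℕ n → Bool
  is01 = V.foldr′ (λ a b → (a <ᵇ 2) ∧ b) true

  is01-χ : ∀ {n} (S : Subset n) → is01 (χ S) ≡ true
  is01-χ []          = refl
  is01-χ (false ∷ S) = is01-χ S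
  is01-χ (true ∷ S)  = is01-χ S

  support-χ : ∀ {n} (S : Subset n) → V.map (λ a → not (a ≡ᵇ 0)) (χ S) ≡ S
  support-χ []          = refl
  support-χ (false ∷ S) = cong (false ∷_) (support-χ S)
  support-χ (true ∷ S)  = cong (true ∷_) (support-χ S)

  ∑-applyUpTo-zero : ∀ (m : ℕ) (g h : ℕ → ℕ) → (∀ i → h (g i) ≡ 0) → ∑ (L.applyUpTo g m) h ≡ 0
  ∑-applyUpTo-zero zero    g h e = refl
  ∑-applyUpTo-zero (suc m) g h e rewrite e 0 = ∑-applyUpTo-zero m (λ i → g (suc i)) h (λ i → e (suc i))

  -- The convolution in _·P_ runs over all β ≤ α; when F vanishes off 0/1-vectors only β = χ S survive.
  ∑-belowVecs-01 : ∀ n (α : Vec ℕ n) (F H : Vec ℕ n → ℕ) → (∀ β → is01 β ≡ false → F β ≡ 0) →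
    ∑ (belowVecs α) (λ β → F β * H (V.zipWith _∸_ α β)) ≡
    ∑ (allSubsets n) (λ S → 𝟙 (χ S ≤ᵥᵇ α) * (F (χ S) * H (V.zipWith _∸_ α (χ S))))
  ∑-belowVecs-01 zero    []      F H e = cong (_+ 0) (sym (+-identityʳ _))
  ∑-belowVecs-01 (suc n) (a ∷ α) F H e =
    trans (∑-concatMap (L.upTo (suc a)) (λ b → L.map (b ∷_) (belowVecs α)) _)
    (trans (∑-cong (L.upTo (suc a)) (λ b → ∑-map (belowVecs α) (b ∷_) _))
    (trans (head-digit a H)
    (sym (∑-allVecs-suc n _ _))))
    where
    IH : ∀ c H' → ∑ (belowVecs α) (λ β → F (c ∷ β) * H' (V.zipWith _∸_ α β)) ≡
                  ∑ (allSubsets n) (λ S → 𝟙 (χ S ≤ᵥᵇ α) * (F (c ∷ χ S) * H' (V.zipWith _∸_ α (χ S))))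
    IH c H' = ∑-belowVecs-01 n α (λ β → F (c ∷ β)) H' (λ β q → e (c ∷ β) (trans (cong ((c <ᵇ 2) ∧_) q) (∧-zeroʳ _)))
    head-digit : ∀ a (H : Vec ℕ (suc n) → ℕ) →
      ∑ (L.upTo (suc a)) (λ b → ∑ (belowVecs α) (λ β → F (b ∷ β) * H (V.zipWith _∸_ (a ∷ α) (b ∷ β)))) ≡
      ∑ (false L.∷ true L.∷ L.[]) (λ b → ∑ (allSubsets n) (λ S →
        𝟙 (χ (b ∷ S) ≤ᵥᵇ (a ∷ α)) * (F (χ (b ∷ S)) * H (V.zipWith _∸_ (a ∷ α) (χ (b ∷ S))))))
    head-digit zero H = cong₂ _+_ (IH 0 (λ w → H (zero ∷ w)))
       (sym (trans (+-identityʳ _) (∑-zero (allSubsets n) (λ S → refl))))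
    head-digit (suc a) H = cong₂ _+_ (IH 0 (λ w → H (suc a ∷ w)))
       (cong₂ _+_ (IH 1 (λ w → H (a ∷ w)))
         (∑-applyUpTo-zero a (λ i → suc (suc i)) _ (λ i → ∑-zero (belowVecs α) (λ β → cong (_* _) (e _ refl)))))

  allPointwise : ∀ {n p} → Vec (Subset n → Bool) p → Vec (Subset n) p → Bool
  allPointwise []       []      = true
  allPointwise (g ∷ gs) (S ∷ I) = g S ∧ allPointwise gs I

  allPointwise-map : ∀ {n m} {A : Set} (f : A → Subset n → Bool) (v : Vec A m) (S : Vec (Subset n) m) →
    allPointwise (V.map f v) S ≡ allFin (λ t → f (lookup v t) (lookup S t))
  allPointwise-map f v S = T-ext (λ t → allFin-complete _ (sound v S t)) (λ t → complete v S (allFin-sound _ t))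
    where
    sound : ∀ {m} (v : Vec _ m) S → T (allPointwise (V.map f v) S) → ∀ t → T (f (lookup v t) (lookup S t))
    sound (a ∷ v) (s ∷ S) t fz     = T-∧ˡ t
    sound (a ∷ v) (s ∷ S) t (fs i) = sound v S (T-∧ʳ {f a s} t) i
    complete : ∀ {m} (v : Vec _ m) S → (∀ t → T (f (lookup v t) (lookup S t))) → T (allPointwise (V.map f v) S)
    complete []      []      h = _
    complete (a ∷ v) (s ∷ S) h = T-∧⁺ (h fz) (complete v S (λ t → h (fs t)))

  multiplicity : ∀ {n p} → Vec (Subset n) p → Vec ℕ n
  multiplicity []      = V.replicate _ 0
  multiplicity (S ∷ I) = V.zipWith _+_ (χ S) (multiplicity I)

  tupleCount : ∀ {n p} → Vec (Subset n → Bool) p → Vec ℕ n → ℕ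
  tupleCount {n} {p} gs α = ∑ (allVecs p (allSubsets n)) (λ I → 𝟙 (allPointwise gs I ∧ (multiplicity I ≡ᵥᵇ α)))

  indepOfSize : ∀ {n} → Matroid n → ℤ → Subset n → Bool
  indepOfSize M z S = indep M S ∧ ⌊ ℤ.+ ∣ S ∣ ℤ.≟ z ⌋

  oneP≡𝟙 : ∀ {n} (α : Vec ℕ n) → oneP α ≡ 𝟙 (V.replicate n 0 ≡ᵥᵇ α)
  oneP≡𝟙 []          = refl
  oneP≡𝟙 (zero ∷ α)  = oneP≡𝟙 α
  oneP≡𝟙 (suc a ∷ α) = refl

  <ᵇ-suc : ∀ x a → (x <ᵇ suc a) ≡ (x ≤ᵇ a)
  <ᵇ-suc zero    a = refl
  <ᵇ-suc (suc x) a = refl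

  ≡ᵇ-split : ∀ x y a → ((x + y) ≡ᵇ a) ≡ ((x ≤ᵇ a) ∧ (y ≡ᵇ (a ∸ x)))
  ≡ᵇ-split zero    y a       = refl
  ≡ᵇ-split (suc x) y zero    = refl
  ≡ᵇ-split (suc x) y (suc a) rewrite <ᵇ-suc x a = ≡ᵇ-split x y a

  ≡ᵥᵇ-split : ∀ {n} (u w α : Vec ℕ n) → (V.zipWith _+_ u w ≡ᵥᵇ α) ≡ ((u ≤ᵥᵇ α) ∧ (w ≡ᵥᵇ V.zipWith _∸_ α u))
  ≡ᵥᵇ-split []      []      []      = refl
  ≡ᵥᵇ-split (x ∷ u) (y ∷ w) (a ∷ α) rewrite ≡ᵇ-split x y a | ≡ᵥᵇ-split u w α =
    ∧-interchange (x ≤ᵇ a) (y ≡ᵇ (a ∸ x)) (u ≤ᵥᵇ α) (w ≡ᵥᵇ V.zipWith _∸_ α u)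

  ≡ᵇ≡⌊≟⌋ : ∀ m j → (m ≡ᵇ j) ≡ ⌊ ℤ.+ m ℤ.≟ ℤ.+ j ⌋
  ≡ᵇ≡⌊≟⌋ m j = T-ext (λ t → fromWitness (cong ℤ.+_ (≡ᵇ⇒≡ m j t)))
                     (λ t → ≡⇒≡ᵇ m j (ℤP.+-injective (toWitness t)))

  fpoly-χ : ∀ {n} (M : Matroid n) (z : ℤ) (S : Subset n) → fpoly z M (χ S) ≡ 𝟙 (indepOfSize M z S)
  fpoly-χ M (ℤ.+ j) S rewrite is01-χ S | support-χ S = cong (λ b → 𝟙 (indep M S ∧ b)) (≡ᵇ≡⌊≟⌋ ∣ S ∣ j)
  fpoly-χ M -[1+ j ] S with ℤ.+ ∣ S ∣ ℤ.≟ -[1+ j ]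
  ... | no _ = cong 𝟙 (sym (∧-zeroʳ (indep M S)))

  fpoly-non01 : ∀ {n} (M : Matroid n) (z : ℤ) (β : Vec ℕ n) → is01 β ≡ false → fpoly z M β ≡ 0
  fpoly-non01 M (ℤ.+ j)  β e rewrite e = refl
  fpoly-non01 M -[1+ _ ] β e = refl

  module _ {n : ℕ} (M : Matroid n) {A : Set} (e : A → ℤ) where
    prodP-fpoly≡tupleCount : ∀ {p} (v : Vec A p) (α : Vec ℕ n) →
      prodP (V.map (λ a → fpoly (e a) M) v) α ≡ tupleCount (V.map (λ a → indepOfSize M (e a)) v) α
    prodP-fpoly≡tupleCount []      α = trans (oneP≡𝟙 α) (sym (+-identityʳ _))
    prodP-fpoly≡tupleCount {suc p} (a ∷ v) α =
      trans (∑-belowVecs-01 n α (fpoly (e a) M) (prodP (V.map (λ a → fpoly (e a) M) v)) (fpoly-non01 M (e a)))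
      (trans (∑-cong (allSubsets n) (λ S → cong₂ (λ u w → 𝟙 (χ S ≤ᵥᵇ α) * (u * w)) (fpoly-χ M (e a) S)
                                            (prodP-fpoly≡tupleCount v (V.zipWith _∸_ α (χ S)))))
      (sym (trans (∑-allVecs-suc p (allSubsets n) _)
        (∑-cong (allSubsets n) λ S →
          trans (∑-cong (allVecs p (allSubsets n)) (λ I → split S I))
          (trans (∑-*ˡ (allVecs p (allSubsets n)) (𝟙 (χ S ≤ᵥᵇ α)) (λ I → 𝟙 (indepOfSize M (e a) S) * rest S I))
           (cong (𝟙 (χ S ≤ᵥᵇ α) *_) (∑-*ˡ (allVecs p (allSubsets n)) (𝟙 (indepOfSize M (e a) S)) (rest S))))))))
      where
      gs = V.map (λ a → indepOfSize M (e a)) v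
      g = indepOfSize M (e a)
      rest : Subset n → Vec (Subset n) p → ℕ
      rest S I = 𝟙 (allPointwise gs I ∧ (multiplicity I ≡ᵥᵇ V.zipWith _∸_ α (χ S)))
      split : ∀ S I → 𝟙 ((g S ∧ allPointwise gs I) ∧ (multiplicity (S ∷ I) ≡ᵥᵇ α)) ≡
        𝟙 (χ S ≤ᵥᵇ α) * (𝟙 (g S) * rest S I)
      split S I rewrite ≡ᵥᵇ-split (χ S) (multiplicity I) α
        | ∧-interchange (g S) (allPointwise gs I) (χ S ≤ᵥᵇ α) (multiplicity I ≡ᵥᵇ V.zipWith _∸_ α (χ S))
        | 𝟙-∧ (g S ∧ (χ S ≤ᵥᵇ α)) (allPointwise gs I ∧ (multiplicity I ≡ᵥᵇ V.zipWith _∸_ α (χ S)))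
        | 𝟙-∧ (g S) (χ S ≤ᵥᵇ α) =
        trans (cong (_* rest S I) (*-comm (𝟙 (g S)) (𝟙 (χ S ≤ᵥᵇ α))))
              (*-assoc (𝟙 (χ S ≤ᵥᵇ α)) (𝟙 (g S)) (rest S I))

  allFin-≡ᵇ≡≡ᵥᵇ : ∀ {m} (u α : Vec ℕ m) → allFin (λ x → lookup u x ≡ᵇ lookup α x) ≡ (u ≡ᵥᵇ α)
  allFin-≡ᵇ≡≡ᵥᵇ u α = T-ext
    (λ t → ≡ᵥᵇ-complete u α (λ x → ≡ᵇ⇒≡ _ _ (allFin-sound _ t x)))
    (λ t → allFin-complete _ (λ x → ≡⇒≡ᵇ _ _ (≡ᵥᵇ-sound u α t x)))

  prodP-fpoly-coefficient : ∀ {n p} (M : Matroid n) {A : Set} (e : A → ℤ) (v : Vec A p) (α : Vec ℕ n) →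
    prodP (V.map (λ a → fpoly (e a) M) v) α ≡
    ∑ (allVecs p (allSubsets n)) (λ S → 𝟙 (allFin (λ t → indepOfSize M (e (lookup v t)) (lookup S t)) ∧ (multiplicity S ≡ᵥᵇ α)))
  prodP-fpoly-coefficient {n} {p} M e v α =
    trans (prodP-fpoly≡tupleCount M e v α)
          (∑-cong (allVecs p (allSubsets n)) (λ S →
            cong (λ b → 𝟙 (b ∧ (multiplicity S ≡ᵥᵇ α))) (allPointwise-map (λ a → indepOfSize M (e a)) v S)))

  -- Distributing the copies of one element over the blocks containing it

  -- Data.Fin.Subset._─_ goes through a where-bound helper indexed by both arguments, so
  -- (a ∷ g) ─ (b ∷ r) does not reduce to a cons of g ─ r; this difference does.
  infixl 5 _∖_
  _∖_ : ∀ {q} → Subset q → Subset q → Subset q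
  g ∖ r = V.zipWith (λ a b → a ∧ not b) g r

  p∖⊥≡p : ∀ {q} (g : Subset q) → g ∖ ⊥ ≡ g
  p∖⊥≡p []          = refl
  p∖⊥≡p (false ∷ g) = cong (false ∷_) (p∖⊥≡p g)
  p∖⊥≡p (true ∷ g)  = cong (true ∷_) (p∖⊥≡p g)

  rowFits : ∀ {q} → Bool → Subset q → Bool
  rowFits c row = if c then ∣ row ∣ ≡ᵇ 1 else ∣ row ∣ ≡ᵇ 0

  distributesᵇ : ∀ {q r} → Vec Bool r → Subset q → Vec (Subset q) r → Bool
  distributesᵇ []        g []        = ∣ g ∣ ≡ᵇ 0
  distributesᵇ (c ∷ col) g (row ∷ R) = rowFits c row ∧ ((row ⊆ᵇ g) ∧ distributesᵇ col (g ∖ row) R)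

  record Distributes {q r} (col : Vec Bool r) (g : Subset q) (R : Vec (Subset q) r) : Set where
    field
      fits     : ∀ t → T (rowFits (lookup col t) (lookup R t))
      disjoint : ∀ s t → ¬ s ≡ t → ∀ j → T (lookup (lookup R s) j) → ¬ T (lookup (lookup R t) j)
      covers   : ∀ j → T (lookup g j) → ∃ λ t → T (lookup (lookup R t) j)
      inside   : ∀ t j → T (lookup (lookup R t) j) → T (lookup g j)

  T-∖⁻ : ∀ {q} (g r : Subset q) j → T (lookup (g ∖ r) j) → T (lookup g j) × ¬ T (lookup r j)
  T-∖⁻ (true ∷ g)  (false ∷ r) fz     t = _ , λ ()
  T-∖⁻ (false ∷ g) (b ∷ r)     fz     ()
  T-∖⁻ (true ∷ g)  (true ∷ r)  fz     ()
  T-∖⁻ (a ∷ g)     (b ∷ r)     (fs j) t = T-∖⁻ g r j t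

  T-∖⁺ : ∀ {q} (g r : Subset q) j → T (lookup g j) → ¬ T (lookup r j) → T (lookup (g ∖ r) j)
  T-∖⁺ (true ∷ g)  (false ∷ r) fz     a b = _
  T-∖⁺ (true ∷ g)  (true ∷ r)  fz     a b = b _
  T-∖⁺ (false ∷ g) (c ∷ r)     fz     () b
  T-∖⁺ (x ∷ g)     (c ∷ r)     (fs j) a b = T-∖⁺ g r j a b

  distributesᵇ-sound : ∀ {q r} (col : Vec Bool r) (g : Subset q) R → T (distributesᵇ col g R) → Distributes col g R
  distributesᵇ-sound [] g [] t = record
    { fits = λ () ; disjoint = λ () ; covers = λ j x → ⊥-elim (∣p∣≡0⇒∉ g j (≡ᵇ⇒≡ _ _ t) x) ; inside = λ () }
  distributesᵇ-sound (c ∷ col) g (row ∷ R) t = record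
    { fits = λ { fz → T-∧ˡ t ; (fs i) → D.fits i } ; disjoint = disjoint ; covers = covers ; inside = inside }
    where
    row⊆g = T-∧ˡ (T-∧ʳ {rowFits c row} t)
    module D = Distributes (distributesᵇ-sound col (g ∖ row) R (T-∧ʳ {row ⊆ᵇ g} (T-∧ʳ {rowFits c row} t)))
    disjoint : ∀ s t → ¬ s ≡ t → ∀ j → T (lookup (lookup (row ∷ R) s) j) → ¬ T (lookup (lookup (row ∷ R) t) j)
    disjoint fz     fz     ne = ⊥-elim (ne refl)
    disjoint fz     (fs t) ne j a b = proj₂ (T-∖⁻ g row j (D.inside t j b)) a
    disjoint (fs s) fz     ne j a b = proj₂ (T-∖⁻ g row j (D.inside s j a)) b
    disjoint (fs s) (fs t) ne j = D.disjoint s t (λ e → ne (cong fs e)) j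
    covers : ∀ j → T (lookup g j) → ∃ λ t → T (lookup (lookup (row ∷ R) t) j)
    covers j x with lookup row j in e
    ... | true  = fz , ≡true⇒T e
    ... | false with D.covers j (T-∖⁺ g row j x (λ y → subst T e y))
    ...   | t , y = fs t , y
    inside : ∀ t j → T (lookup (lookup (row ∷ R) t) j) → T (lookup g j)
    inside fz     j x = ⊆ᵇ-sound row g row⊆g j x
    inside (fs t) j x = proj₁ (T-∖⁻ g row j (D.inside t j x))

  distributesᵇ-complete : ∀ {q r} (col : Vec Bool r) (g : Subset q) R → Distributes col g R → T (distributesᵇ col g R)
  distributesᵇ-complete [] g [] D = ≡⇒≡ᵇ _ _ (∉⇒∣p∣≡0 g (λ j x → noBlock (Distributes.covers D j x)))
    where
    noBlock : ∀ {P : Fin 0 → Set} → ∃ P → Empty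
    noBlock (() , _)
  distributesᵇ-complete (c ∷ col) g (row ∷ R) D =
    T-∧⁺ (fits fz) (T-∧⁺ (⊆ᵇ-complete row g (inside fz)) (distributesᵇ-complete col (g ∖ row) R (record
      { fits = λ t → fits (fs t)
      ; disjoint = λ s t ne → disjoint (fs s) (fs t) (λ e → ne (fs-injective e))
      ; covers = covers′
      ; inside = λ t j x → T-∖⁺ g row j (inside (fs t) j x) (λ y → disjoint fz (fs t) (λ ()) j y x) })))
    where
    open Distributes D
    covers′ : ∀ j → T (lookup (g ∖ row) j) → ∃ λ t → T (lookup (lookup R t) j)
    covers′ j x with T-∖⁻ g row j x
    ... | gj , ¬rj with covers j gj
    ...   | fz   , y = ⊥-elim (¬rj y)
    ...   | fs t , y = t , y

  rowFits-sound : ∀ {q} c (row : Subset q) → T (rowFits c row) → (not (∣ row ∣ ≡ᵇ 0) ≡ c) × T (∣ row ∣ <ᵇ 2)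
  rowFits-sound false row t with ∣ row ∣
  ... | zero = refl , _
  rowFits-sound true row t with ∣ row ∣
  ... | suc zero = refl , _

  rowFits-complete : ∀ {q} c (row : Subset q) → not (∣ row ∣ ≡ᵇ 0) ≡ c → T (∣ row ∣ <ᵇ 2) → T (rowFits c row)
  rowFits-complete c row e t with ∣ row ∣
  rowFits-complete false row refl t | zero     = _
  rowFits-complete true  row refl t | suc zero = _

  ⊥⊆ᵇ : ∀ {q} (g : Subset q) → (⊥ ⊆ᵇ g) ≡ true
  ⊥⊆ᵇ []      = refl
  ⊥⊆ᵇ (a ∷ g) = ⊥⊆ᵇ g

  ∑-singletons⊆ : ∀ {q} (g : Subset q) → ∑ (allSubsets q) (λ row → 𝟙 ((∣ row ∣ ≡ᵇ 1) ∧ (row ⊆ᵇ g))) ≡ ∣ g ∣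
  ∑-singletons⊆ []              = refl
  ∑-singletons⊆ {suc q} (a ∷ g) =
    trans (∑-allVecs-suc q _ _)
    (trans (cong₂ _+_ (∑-singletons⊆ g)
       (trans (+-identityʳ _)
         (trans (enumerates-allSubsets q ⊥ _ (λ r r≢ → nonempty r r≢))
                (cong₂ (λ u w → 𝟙 ((u ≡ᵇ 0) ∧ (a ∧ w))) (∣⊥∣≡0 q) (⊥⊆ᵇ g)))))
     (head a))
    where
    nonempty : ∀ r → ¬ r ≡ ⊥ → 𝟙 ((∣ r ∣ ≡ᵇ 0) ∧ (a ∧ (r ⊆ᵇ g))) ≡ 0
    nonempty r r≢ with ∣ r ∣ in e
    ... | zero  = ⊥-elim (r≢ (∣p∣≡0⇒p≡⊥ r e))
    ... | suc _ = refl
    head : ∀ a → ∣ g ∣ + 𝟙 (a ∧ true) ≡ ∣ a ∷ g ∣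
    head false = +-identityʳ _
    head true  = +-comm _ 1

  ∣p∖singleton∣ : ∀ {q} (row g : Subset q) → ∣ row ∣ ≡ 1 → T (row ⊆ᵇ g) → suc ∣ g ∖ row ∣ ≡ ∣ g ∣
  ∣p∖singleton∣ (true ∷ row)  (true ∷ g)  e s rewrite ∣p∣≡0⇒p≡⊥ row (suc-injective e) | p∖⊥≡p g = refl
  ∣p∖singleton∣ (false ∷ row) (false ∷ g) e s = ∣p∖singleton∣ row g e s
  ∣p∖singleton∣ (false ∷ row) (true ∷ g)  e s = cong suc (∣p∖singleton∣ row g e s)

  !-step : ∀ c g → g * ((c !) * 𝟙 (c ≡ᵇ (g ∸ 1))) ≡ (suc c !) * 𝟙 (suc c ≡ᵇ g)
  !-step c zero = sym (*-zeroʳ (suc c !))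
  !-step c (suc m) with c ≡ᵇ m in e
  ... | false = trans (cong₂ _+_ (*-zeroʳ (c !)) (trans (cong (m *_) (*-zeroʳ (c !))) (*-zeroʳ m))) (sym (*-zeroʳ (suc c !)))
  ... | true rewrite ≡ᵇ⇒≡ c m (≡true⇒T e) = ring (m !) m
    where
    ring : ∀ a m → a * 1 + m * (a * 1) ≡ (a + m * a) * 1
    ring = solve-∀

  module _ {q r} (col : Vec Bool r) (g : Subset q) where
    private
      rest : Subset q → ℕ
      rest row = (∣ col ∣ !) * 𝟙 (∣ col ∣ ≡ᵇ ∣ g ∖ row ∣)

    ∑-first-row : ∀ c → ∑ (allSubsets q) (λ row → 𝟙 (rowFits c row ∧ (row ⊆ᵇ g)) * rest row)
                      ≡ (∣ c ∷ col ∣ !) * 𝟙 (∣ c ∷ col ∣ ≡ᵇ ∣ g ∣)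
    ∑-first-row false =
      trans (enumerates-allSubsets q ⊥ _ nonempty)
        (trans (cong₂ (λ v u → 𝟙 ((v ≡ᵇ 0) ∧ u) * rest ⊥) (∣⊥∣≡0 q) (⊥⊆ᵇ g))
          (trans (+-identityʳ _) (cong (λ w → (∣ col ∣ !) * 𝟙 (∣ col ∣ ≡ᵇ ∣ w ∣)) (p∖⊥≡p g))))
      where
      nonempty : ∀ r → ¬ r ≡ ⊥ → 𝟙 (rowFits false r ∧ (r ⊆ᵇ g)) * rest r ≡ 0
      nonempty r r≢ with ∣ r ∣ in e
      ... | zero  = ⊥-elim (r≢ (∣p∣≡0⇒p≡⊥ r e))
      ... | suc _ = refl
    -- Each of the ∣ g ∣ singletons of g leaves ∣ g ∣ - 1 copies for the remaining blocks.
    ∑-first-row true =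
      trans (∑-cong (allSubsets q) singleton)
        (trans (∑-*ʳ (allSubsets q) rest₀ (λ row → 𝟙 ((∣ row ∣ ≡ᵇ 1) ∧ (row ⊆ᵇ g))))
          (trans (cong (_* rest₀) (∑-singletons⊆ g)) (!-step ∣ col ∣ ∣ g ∣)))
      where
      rest₀ = (∣ col ∣ !) * 𝟙 (∣ col ∣ ≡ᵇ (∣ g ∣ ∸ 1))
      singleton : ∀ row → 𝟙 (rowFits true row ∧ (row ⊆ᵇ g)) * rest row ≡ 𝟙 ((∣ row ∣ ≡ᵇ 1) ∧ (row ⊆ᵇ g)) * rest₀
      singleton row with ∣ row ∣ ≡ᵇ 1 in e1 | row ⊆ᵇ g in e2
      ... | false | _     = refl
      ... | true  | false = refl
      ... | true  | true  = cong (λ w → 1 * ((∣ col ∣ !) * 𝟙 (∣ col ∣ ≡ᵇ w)))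
             (cong (_∸ 1) (∣p∖singleton∣ row g (≡ᵇ⇒≡ _ _ (≡true⇒T e1)) (≡true⇒T e2)))

  ∑-distributesᵇ : ∀ {q r} (col : Vec Bool r) (g : Subset q) →
    ∑ (allVecs r (allSubsets q)) (λ R → 𝟙 (distributesᵇ col g R)) ≡ (∣ col ∣ !) * 𝟙 (∣ col ∣ ≡ᵇ ∣ g ∣)
  ∑-distributesᵇ [] g = trans (+-identityʳ _) (trans (cong 𝟙 (≡ᵇ-sym ∣ g ∣ 0)) (sym (+-identityʳ _)))
    where
    ≡ᵇ-sym : ∀ m k → (m ≡ᵇ k) ≡ (k ≡ᵇ m)
    ≡ᵇ-sym m k = T-ext (λ t → ≡⇒≡ᵇ k m (sym (≡ᵇ⇒≡ m k t))) (λ t → ≡⇒≡ᵇ m k (sym (≡ᵇ⇒≡ k m t)))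
  ∑-distributesᵇ {q} {suc r} (c ∷ col) g =
    trans (∑-allVecs-suc r (allSubsets q) (λ R → 𝟙 (distributesᵇ (c ∷ col) g R)))
    (trans (∑-cong (allSubsets q) (λ row →
       trans (∑-cong (allVecs r (allSubsets q)) (λ R →
               trans (cong 𝟙 (sym (∧-assoc (rowFits c row) (row ⊆ᵇ g) _)))
                     (𝟙-∧ (rowFits c row ∧ (row ⊆ᵇ g)) (distributesᵇ col (g ∖ row) R))))
       (trans (∑-*ˡ (allVecs r (allSubsets q)) (𝟙 (rowFits c row ∧ (row ⊆ᵇ g))) (λ R → 𝟙 (distributesᵇ col (g ∖ row) R)))
         (cong (𝟙 (rowFits c row ∧ (row ⊆ᵇ g)) *_) (∑-distributesᵇ col (g ∖ row))))))
     (∑-first-row col g c))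

  !*𝟙≡ᵇ : ∀ c a → (c !) * 𝟙 (c ≡ᵇ a) ≡ (a !) * 𝟙 (c ≡ᵇ a)
  !*𝟙≡ᵇ c a with c ≡ᵇ a in e
  ... | true rewrite ≡ᵇ⇒≡ c a (≡true⇒T e) = refl
  ... | false = trans (*-zeroʳ (c !)) (sym (*-zeroʳ (a !)))

  columns : ∀ {A : Set} {p n} → Vec (Vec A p) n → Vec (Vec A n) p
  columns {p = p} [] = V.replicate p []
  columns (c ∷ B)    = V.zipWith _∷_ c (columns B)

  column : ∀ {A : Set} {p n} → Fin n → Vec (Vec A n) p → Vec A p
  column x A = V.map (λ S → lookup S x) A

  lookup-column : ∀ {A : Set} {p n} (x : Fin n) (A : Vec (Vec A n) p) t → lookup (column x A) t ≡ lookup (lookup A t) x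
  lookup-column x A t = lookup-map t (λ S → lookup S x) A

  column-zero : ∀ {A : Set} {p n} (c : Vec A p) (R : Vec (Vec A n) p) → column fz (V.zipWith _∷_ c R) ≡ c
  column-zero []      []      = refl
  column-zero (a ∷ c) (r ∷ R) = cong (a ∷_) (column-zero c R)

  column-suc : ∀ {A : Set} {p n} (x : Fin n) (c : Vec A p) (R : Vec (Vec A n) p) →
    column (fs x) (V.zipWith _∷_ c R) ≡ column x R
  column-suc x []      []      = refl
  column-suc x (a ∷ c) (r ∷ R) = cong (lookup r x ∷_) (column-suc x c R)

  column-columns : ∀ {A : Set} {p n} (x : Fin n) (B : Vec (Vec A p) n) → column x (columns B) ≡ lookup B x
  column-columns fz     (c ∷ B) = column-zero c (columns B)
  column-columns (fs x) (c ∷ B) = trans (column-suc x c (columns B)) (column-columns x B)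

  module _ {A : Set} (xs : List A) where
    ∑-allVecs-cons : ∀ p n (h : Vec (Vec A (suc n)) p → ℕ) →
      ∑ (allVecs p (allVecs (suc n) xs)) h ≡
      ∑ (allVecs p xs) (λ c → ∑ (allVecs p (allVecs n xs)) (λ R → h (V.zipWith _∷_ c R)))
    ∑-allVecs-cons zero    n h = sym (+-identityʳ _)
    ∑-allVecs-cons (suc p) n h =
      trans (∑-allVecs-suc p (allVecs (suc n) xs) h)
      (trans (∑-allVecs-suc n xs (λ a → ∑ (allVecs p (allVecs (suc n) xs)) (λ R → h (a ∷ R))))
      (trans (∑-cong xs (λ a₀ → ∑-cong (allVecs n xs) (λ a → ∑-allVecs-cons p n (λ R → h ((a₀ ∷ a) ∷ R)))))
      (trans (∑-cong xs (λ a₀ → ∑-comm (allVecs n xs) (allVecs p xs) _))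
      (trans (∑-cong xs (λ a₀ → ∑-cong (allVecs p xs) (λ c → sym (∑-allVecs-suc p (allVecs n xs) _))))
      (sym (∑-allVecs-suc p xs _))))))

    ∑-columns : ∀ p n (h : Vec (Vec A n) p → ℕ) →
      ∑ (allVecs p (allVecs n xs)) h ≡ ∑ (allVecs n (allVecs p xs)) (λ B → h (columns B))
    ∑-columns p zero    h = trans (∑-allVecs-singleton [] p h) (sym (+-identityʳ _))
    ∑-columns p (suc n) h =
      trans (∑-allVecs-cons p n h)
      (trans (∑-cong (allVecs p xs) (λ c → ∑-columns p n (λ R → h (V.zipWith _∷_ c R))))
      (sym (∑-allVecs-suc n (allVecs p xs) _)))

  ∣column∣≡multiplicity : ∀ {n m} (x : Fin n) (I : Vec (Subset n) m) → ∣ column x I ∣ ≡ lookup (multiplicity I) x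
  ∣column∣≡multiplicity x []      = sym (lookup-replicate x 0)
  ∣column∣≡multiplicity x (S ∷ I) rewrite lookup-zipWith _+_ x (χ S) (multiplicity I) | lookup-map x 𝟙 S
    with lookup S x
  ... | true  = cong suc (∣column∣≡multiplicity x I)
  ... | false = ∣column∣≡multiplicity x I

  module _ {n c : ℕ} where
    Mem : USub n c → Fin n → Fin c → Set
    Mem S x j = T (lookup (lookup S x) j)

    foldr∧-sound : ∀ {m} (bs : Vec Bool m) → T (V.foldr′ _∧_ true bs) → ∀ i → T (lookup bs i)
    foldr∧-sound (b ∷ bs) t fz     = T-∧ˡ t
    foldr∧-sound (b ∷ bs) t (fs i) = foldr∧-sound bs (T-∧ʳ {b} t) i

    foldr∧-complete : ∀ {m} (bs : Vec Bool m) → (∀ i → T (lookup bs i)) → T (V.foldr′ _∧_ true bs)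
    foldr∧-complete []       f = _
    foldr∧-complete (b ∷ bs) f = T-∧⁺ (f fz) (foldr∧-complete bs (λ i → f (fs i)))

    ⊆Uᵇ-sound : (A B : USub n c) → T (A ⊆Uᵇ B) → ∀ x j → Mem A x j → Mem B x j
    ⊆Uᵇ-sound A B t x j m = ⊆ᵇ-sound (lookup A x) (lookup B x)
       (subst T (lookup-zipWith _⊆ᵇ_ x A B) (foldr∧-sound (V.zipWith _⊆ᵇ_ A B) t x)) j m

    ⊆Uᵇ-complete : (A B : USub n c) → (∀ x j → Mem A x j → Mem B x j) → T (A ⊆Uᵇ B)
    ⊆Uᵇ-complete A B f = foldr∧-complete (V.zipWith _⊆ᵇ_ A B) (λ x →
       subst T (sym (lookup-zipWith _⊆ᵇ_ x A B)) (⊆ᵇ-complete (lookup A x) (lookup B x) (f x)))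

    lookup-∪U : (A B : USub n c) → ∀ x j → lookup (lookup (A ∪U B) x) j ≡ (lookup (lookup A x) j ∨ lookup (lookup B x) j)
    lookup-∪U A B x j = trans (cong (λ r → lookup r j) (lookup-zipWith _∪_ x A B)) (lookup-∪ (lookup A x) (lookup B x) j)

    lookup-∩U : (A B : USub n c) → ∀ x j → lookup (lookup (A ∩U B) x) j ≡ (lookup (lookup A x) j ∧ lookup (lookup B x) j)
    lookup-∩U A B x j =
      trans (cong (λ r → lookup r j) (lookup-zipWith _∩_ x A B)) (lookup-zipWith _∧_ j (lookup A x) (lookup B x))

    Mem-∪U⁻ : ∀ (A B : USub n c) x j → Mem (A ∪U B) x j → Mem A x j ⊎ Mem B x j
    Mem-∪U⁻ A B x j m = T-∨⁻ {lookup (lookup A x) j} (subst T (lookup-∪U A B x j) m)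

    Mem-∪Uˡ : ∀ (A B : USub n c) x j → Mem A x j → Mem (A ∪U B) x j
    Mem-∪Uˡ A B x j m = subst T (sym (lookup-∪U A B x j)) (T-∨ˡ m)

    Mem-∪Uʳ : ∀ (A B : USub n c) x j → Mem B x j → Mem (A ∪U B) x j
    Mem-∪Uʳ A B x j m = subst T (sym (lookup-∪U A B x j)) (T-∨ʳ {lookup (lookup A x) j} m)

    ¬Mem-emptyU : ∀ x j → ¬ Mem (emptyU {n} {c}) x j
    ¬Mem-emptyU x j m rewrite lookup-replicate x (⊥ {c}) | lookup-⊥ {c} j = m

    ⋃U-sound : ∀ {m} (A : Vec (USub n c) m) x j → Mem (V.foldr′ _∪U_ emptyU A) x j → ∃ λ t → Mem (lookup A t) x j
    ⋃U-sound []      x j m = ⊥-elim (¬Mem-emptyU x j m)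
    ⋃U-sound (S ∷ A) x j m with Mem-∪U⁻ S (V.foldr′ _∪U_ emptyU A) x j m
    ... | inj₁ a = fz , a
    ... | inj₂ b with ⋃U-sound A x j b
    ...   | t , y = fs t , y

    ⋃U-complete : ∀ {m} (A : Vec (USub n c) m) x j t → Mem (lookup A t) x j → Mem (V.foldr′ _∪U_ emptyU A) x j
    ⋃U-complete (S ∷ A) x j fz     y = Mem-∪Uˡ S (V.foldr′ _∪U_ emptyU A) x j y
    ⋃U-complete (S ∷ A) x j (fs t) y = Mem-∪Uʳ S (V.foldr′ _∪U_ emptyU A) x j (⋃U-complete A x j t y)

    record OrderedPartition {m} (Y : USub n c) (A : Vec (USub n c) m) : Set where
      field
        disjoint : ∀ s t → ¬ s ≡ t → ∀ x j → Mem (lookup A s) x j → ¬ Mem (lookup A t) x j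
        covers   : ∀ x j → Mem Y x j → ∃ λ t → Mem (lookup A t) x j
        inside   : ∀ t x j → Mem (lookup A t) x j → Mem Y x j

    module _ {m} (Y : USub n c) (A : Vec (USub n c) m) where
      private
        ⋃A : USub n c
        ⋃A = V.foldr′ _∪U_ emptyU A

        disjointᵇ : Fin m → Fin m → Bool
        disjointᵇ s u = (toℕ s ≡ᵇ toℕ u) ∨ (((lookup A s) ∩U (lookup A u)) ≡Uᵇ emptyU)

        Mem-∩U : ∀ s u x j → Mem (lookup A s ∩U lookup A u) x j →
          T (lookup (lookup (lookup A s) x) j ∧ lookup (lookup (lookup A u) x) j)
        Mem-∩U s u x j m = subst T (lookup-∩U (lookup A s) (lookup A u) x j) m

      isOrderedPartition-sound : T (isOrderedPartition Y A) → OrderedPartition Y A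
      isOrderedPartition-sound t = record { disjoint = disjoint ; covers = covers ; inside = inside }
        where
        pairs : T (allFin (λ s → allFin (λ u → disjointᵇ s u)))
        pairs = T-∧ˡ t
        ⋃A≡Y : T ((⋃A ⊆Uᵇ Y) ∧ (Y ⊆Uᵇ ⋃A))
        ⋃A≡Y = T-∧ʳ {allFin (λ s → allFin (λ u → disjointᵇ s u))} t
        disjoint : ∀ s t → ¬ s ≡ t → ∀ x j → Mem (lookup A s) x j → ¬ Mem (lookup A t) x j
        disjoint s u s≢u x j a b
          with T-∨⁻ {toℕ s ≡ᵇ toℕ u} (allFin-sound (disjointᵇ s) (allFin-sound _ pairs s) u)
        ... | inj₁ e = s≢u (toℕ-injective (≡ᵇ⇒≡ _ _ e))
        ... | inj₂ e = ¬Mem-emptyU x j (⊆Uᵇ-sound (lookup A s ∩U lookup A u) emptyU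
                         (T-∧ˡ {(lookup A s ∩U lookup A u) ⊆Uᵇ emptyU} e) x j
                         (subst T (sym (lookup-∩U (lookup A s) (lookup A u) x j)) (T-∧⁺ a b)))
        covers : ∀ x j → Mem Y x j → ∃ λ t → Mem (lookup A t) x j
        covers x j y = ⋃U-sound A x j (⊆Uᵇ-sound Y ⋃A (T-∧ʳ {⋃A ⊆Uᵇ Y} ⋃A≡Y) x j y)
        inside : ∀ t x j → Mem (lookup A t) x j → Mem Y x j
        inside u x j y = ⊆Uᵇ-sound ⋃A Y (T-∧ˡ ⋃A≡Y) x j (⋃U-complete A x j u y)

      isOrderedPartition-complete : OrderedPartition Y A → T (isOrderedPartition Y A)
      isOrderedPartition-complete P =
        T-∧⁺ (allFin-complete _ (λ s → allFin-complete (disjointᵇ s) (pair s)))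
             (T-∧⁺ (⊆Uᵇ-complete ⋃A Y (λ x j m → let (u , y) = ⋃U-sound A x j m in inside u x j y))
                   (⊆Uᵇ-complete Y ⋃A (λ x j m → let (u , y) = covers x j m in ⋃U-complete A x j u y)))
        where
        open OrderedPartition P
        pair : ∀ s u → T (disjointᵇ s u)
        pair s u with toℕ s ≡ᵇ toℕ u in e
        ... | true  = _
        ... | false = T-∧⁺ {(lookup A s ∩U lookup A u) ⊆Uᵇ emptyU}
                (⊆Uᵇ-complete (lookup A s ∩U lookup A u) emptyU (λ x j m → ⊥-elim (
                   disjoint s u s≢u x j (T-∧ˡ (Mem-∩U s u x j m)) (T-∧ʳ {lookup (lookup (lookup A s) x) j} (Mem-∩U s u x j m)))))
                (⊆Uᵇ-complete emptyU (lookup A s ∩U lookup A u) (λ x j m → ⊥-elim (¬Mem-emptyU x j m)))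
          where
          s≢u : ¬ s ≡ u
          s≢u refl = subst T e (≡⇒≡ᵇ (toℕ s) (toℕ s) refl)

  -- Tuples of sets all containing a fixed set D

  disjointᵇ : ∀ {n} → Subset n → Subset n → Bool
  disjointᵇ []      []      = true
  disjointᵇ (b ∷ J) (d ∷ D) = not (b ∧ d) ∧ disjointᵇ J D

  disjointᵇ-sound : ∀ {n} (J D : Subset n) → T (disjointᵇ J D) → ∀ x → T (lookup J x) → ¬ T (lookup D x)
  disjointᵇ-sound (true ∷ J) (true ∷ D) t fz     a b = t
  disjointᵇ-sound (b ∷ J)    (d ∷ D)    t (fs x)     = disjointᵇ-sound J D (T-∧ʳ {not (b ∧ d)} t) x

  disjointᵇ-complete : ∀ {n} (J D : Subset n) → (∀ x → T (lookup J x) → ¬ T (lookup D x)) → T (disjointᵇ J D)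
  disjointᵇ-complete []          []          f = _
  disjointᵇ-complete (false ∷ J) (d ∷ D)     f = disjointᵇ-complete J D (λ x → f (fs x))
  disjointᵇ-complete (true ∷ J)  (false ∷ D) f = disjointᵇ-complete J D (λ x → f (fs x))
  disjointᵇ-complete (true ∷ J)  (true ∷ D)  f = f fz _ _

  allDisjointᵇ : ∀ {n m} → Vec (Subset n) m → Subset n → Bool
  allDisjointᵇ []      D = true
  allDisjointᵇ (J ∷ I) D = disjointᵇ J D ∧ allDisjointᵇ I D

  allDisjointᵇ-sound : ∀ {n m} (I : Vec (Subset n) m) D → T (allDisjointᵇ I D) → ∀ t → T (disjointᵇ (lookup I t) D)
  allDisjointᵇ-sound (J ∷ I) D a fz     = T-∧ˡ a
  allDisjointᵇ-sound (J ∷ I) D a (fs t) = allDisjointᵇ-sound I D (T-∧ʳ {disjointᵇ J D} a) t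

  allDisjointᵇ-complete : ∀ {n m} (I : Vec (Subset n) m) D → (∀ t → T (disjointᵇ (lookup I t) D)) → T (allDisjointᵇ I D)
  allDisjointᵇ-complete []      D f = _
  allDisjointᵇ-complete (J ∷ I) D f = T-∧⁺ (f fz) (allDisjointᵇ-complete I D (λ t → f (fs t)))

  ∪ᵗ : ∀ {n m} → Subset n → Vec (Subset n) m → Vec (Subset n) m
  ∪ᵗ D I = V.map (_∪ D) I

  ∑-⊇ : ∀ {n} (D : Subset n) (h : Subset n → ℕ) →
    (∀ S x → T (lookup D x) → ¬ T (lookup S x) → h S ≡ 0) →
    ∑ (allSubsets n) h ≡ ∑ (allSubsets n) (λ J → 𝟙 (disjointᵇ J D) * h (J ∪ D))
  ∑-⊇ {zero}  []         h v = cong (_+ 0) (sym (+-identityʳ _))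
  ∑-⊇ {suc n} (true ∷ D) h v =
    trans (∑-allVecs-suc n _ h)
    (trans (cong₂ _+_ (∑-zero (allSubsets n) (λ S → v (false ∷ S) fz _ (λ ())))
                      (cong (_+ 0) (∑-⊇ D (λ S → h (true ∷ S)) (λ S x d ns → v (true ∷ S) (fs x) d ns))))
    (sym (trans (∑-allVecs-suc n _ _)
          (cong₂ _+_ refl (cong (_+ 0) (∑-zero (allSubsets n) (λ S → refl)))))))
  ∑-⊇ {suc n} (false ∷ D) h v =
    trans (∑-allVecs-suc n _ h)
    (trans (cong₂ _+_ (∑-⊇ D (λ S → h (false ∷ S)) (λ S x d ns → v (false ∷ S) (fs x) d ns))
                      (cong (_+ 0) (∑-⊇ D (λ S → h (true ∷ S)) (λ S x d ns → v (true ∷ S) (fs x) d ns))))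
    (sym (∑-allVecs-suc n _ _)))

  ∑-⊇ᵗ : ∀ {n} m (D : Subset n) (F : Vec (Subset n) m → ℕ) →
    (∀ S t x → T (lookup D x) → ¬ T (lookup (lookup S t) x) → F S ≡ 0) →
    ∑ (allVecs m (allSubsets n)) F ≡ ∑ (allVecs m (allSubsets n)) (λ I → 𝟙 (allDisjointᵇ I D) * F (∪ᵗ D I))
  ∑-⊇ᵗ zero D F v = cong (_+ 0) (sym (+-identityʳ _))
  ∑-⊇ᵗ {n} (suc m) D F v =
    trans (∑-allVecs-suc m (allSubsets n) F)
    (trans (∑-cong (allSubsets n) (λ S₀ → ∑-⊇ᵗ m D (λ S → F (S₀ ∷ S)) (λ S t x d ns → v (S₀ ∷ S) (fs t) x d ns)))
    (trans (∑-comm (allSubsets n) (allVecs m (allSubsets n)) _)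
    (trans (∑-cong (allVecs m (allSubsets n)) (λ I → ∑-⊇ D (λ S₀ → 𝟙 (allDisjointᵇ I D) * F (S₀ ∷ ∪ᵗ D I))
              (λ S x d ns → trans (cong (𝟙 (allDisjointᵇ I D) *_) (v (S ∷ ∪ᵗ D I) fz x d ns)) (*-zeroʳ (𝟙 (allDisjointᵇ I D))))))
    (trans (sym (∑-comm (allSubsets n) (allVecs m (allSubsets n)) _))
    (trans (∑-cong (allSubsets n) (λ J → ∑-cong (allVecs m (allSubsets n)) (λ I →
              trans (sym (*-assoc (𝟙 (disjointᵇ J D)) _ _))
                    (cong (_* F ((J ∪ D) ∷ ∪ᵗ D I)) (sym (𝟙-∧ (disjointᵇ J D) (allDisjointᵇ I D)))))))
    (sym (∑-allVecs-suc m (allSubsets n) (λ I → 𝟙 (allDisjointᵇ I D) * F (∪ᵗ D I)))))))))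

  multiplicity-∪ᵗ : ∀ {n m} (D : Subset n) (I : Vec (Subset n) m) → T (allDisjointᵇ I D) → ∀ x →
    lookup (multiplicity (∪ᵗ D I)) x ≡ lookup (multiplicity I) x + m * 𝟙 (lookup D x)
  multiplicity-∪ᵗ D [] a x = sym (+-identityʳ _)
  multiplicity-∪ᵗ {m = suc m} D (J ∷ I) a x
    rewrite lookup-zipWith _+_ x (χ (J ∪ D)) (multiplicity (∪ᵗ D I)) | lookup-zipWith _+_ x (χ J) (multiplicity I)
          | lookup-map x 𝟙 (J ∪ D) | lookup-map x 𝟙 J | lookup-zipWith _∨_ x J D
          | multiplicity-∪ᵗ D I (T-∧ʳ {disjointᵇ J D} a) x
    with lookup J x in eJ | lookup D x in eD
  ... | true  | true  = ⊥-elim (disjointᵇ-sound J D (T-∧ˡ a) x (≡true⇒T eJ) (≡true⇒T eD))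
  ... | true  | false = refl
  ... | false | true  = ring (lookup (multiplicity I) x) m
    where
    ring : ∀ s m → 1 + (s + m * 1) ≡ 0 + s + (1 + m) * 1
    ring = solve-∀
  ... | false | false = cong (lookup (multiplicity I) x +_) (trans (*-zeroʳ m) (sym (*-zeroʳ (suc m))))

  +-cancelʳ-≡ᵇ : ∀ a b c → ((a + c) ≡ᵇ (b + c)) ≡ (a ≡ᵇ b)
  +-cancelʳ-≡ᵇ a b c = T-ext (λ t → ≡⇒≡ᵇ a b (+-cancelʳ-≡ c a b (≡ᵇ⇒≡ _ _ t)))
                             (λ t → ≡⇒≡ᵇ _ _ (cong (_+ c) (≡ᵇ⇒≡ a b t)))

  ℤ+-cancelʳ : ∀ {i j} d → i ℤ.+ d ≡ j ℤ.+ d → i ≡ j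
  ℤ+-cancelʳ {i} {j} d e = trans (i≡i+d-d i d) (trans (cong (ℤ._- d) e) (sym (i≡i+d-d j d)))
    where
    i≡i+d-d : ∀ i d → i ≡ (i ℤ.+ d) ℤ.- d
    i≡i+d-d = ℤRing.solve-∀

  ⌊≟⌋-cancelʳ : ∀ i j d → ⌊ i ℤ.+ d ℤ.≟ j ℤ.+ d ⌋ ≡ ⌊ i ℤ.≟ j ⌋
  ⌊≟⌋-cancelʳ i j d = T-ext (λ t → fromWitness (ℤ+-cancelʳ d (toWitness t))) (λ t → fromWitness (cong (ℤ._+ d) (toWitness t)))

  -- A tuple with multiplicity α + m χ(D), where α vanishes on D, has D in every block;
  -- removing D from every block is then a bijection onto the tuples of multiplicity α.
  module _ {n m : ℕ} (D : Subset n) (α : Vec ℕ n) (α|D≡0 : ∀ x → T (lookup D x) → lookup α x ≡ 0)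
           (h g : Fin m → Subset n → Bool) (h∪D≡g : ∀ t J → T (disjointᵇ J D) → h t (J ∪ D) ≡ g t J) where
    private
      β : Vec ℕ n
      β = tabulate (λ x → lookup α x + m * 𝟙 (lookup D x))

      lookup-β : ∀ x → lookup β x ≡ lookup α x + m * 𝟙 (lookup D x)
      lookup-β = lookup∘tabulate (λ x → lookup α x + m * 𝟙 (lookup D x))

      F : Vec (Subset n) m → ℕ
      F S = 𝟙 (allFin (λ t → h t (lookup S t)) ∧ (multiplicity S ≡ᵥᵇ β))

      G : Vec (Subset n) m → ℕ
      G I = 𝟙 (allFin (λ t → g t (lookup I t)) ∧ (multiplicity I ≡ᵥᵇ α))

      F-⊇D : ∀ S t x → T (lookup D x) → ¬ T (lookup (lookup S t) x) → F S ≡ 0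
      F-⊇D S t x x∈D x∉Sₜ with allFin (λ t → h t (lookup S t)) ∧ (multiplicity S ≡ᵥᵇ β) in e
      ... | false = refl
      ... | true  = ⊥-elim (<⇒≱ (∉⇒∣p∣<n (column x S) t (subst (λ w → ¬ T w) (sym (lookup-column x S t)) x∉Sₜ)) m≤∣column∣)
        where
        m≤∣column∣ : m ≤ ∣ column x S ∣
        m≤∣column∣ rewrite ∣column∣≡multiplicity x S
                         | ≡ᵥᵇ-sound (multiplicity S) β (T-∧ʳ {allFin (λ t → h t (lookup S t))} (≡true⇒T e)) x
                         | lookup-β x | T⇒𝟙≡1 x∈D =
          ≤-trans (≤-reflexive (sym (*-identityʳ m))) (m≤n+m _ _)

      F∘∪ᵗ≡G : ∀ I → 𝟙 (allDisjointᵇ I D) * F (∪ᵗ D I) ≡ G I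
      F∘∪ᵗ≡G I with allDisjointᵇ I D in disj
      ... | true = trans (+-identityʳ _) (cong 𝟙 (T-ext to from))
        where
        hₜ≡gₜ : ∀ t → h t (lookup (∪ᵗ D I) t) ≡ g t (lookup I t)
        hₜ≡gₜ t = trans (cong (h t) (lookup-map t (_∪ D) I)) (h∪D≡g t (lookup I t) (allDisjointᵇ-sound I D (≡true⇒T disj) t))
        mult : ∀ x → (lookup (multiplicity (∪ᵗ D I)) x ≡ᵇ lookup β x) ≡ (lookup (multiplicity I) x ≡ᵇ lookup α x)
        mult x rewrite multiplicity-∪ᵗ D I (≡true⇒T disj) x | lookup-β x =
          +-cancelʳ-≡ᵇ (lookup (multiplicity I) x) (lookup α x) (m * 𝟙 (lookup D x))
        mult-eq : (multiplicity (∪ᵗ D I) ≡ᵥᵇ β) ≡ (multiplicity I ≡ᵥᵇ α)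
        mult-eq = trans (sym (allFin-≡ᵇ≡≡ᵥᵇ (multiplicity (∪ᵗ D I)) β))
                        (trans (allFin-cong mult) (allFin-≡ᵇ≡≡ᵥᵇ (multiplicity I) α))
        to : T (allFin (λ t → h t (lookup (∪ᵗ D I) t)) ∧ (multiplicity (∪ᵗ D I) ≡ᵥᵇ β)) →
             T (allFin (λ t → g t (lookup I t)) ∧ (multiplicity I ≡ᵥᵇ α))
        to u = T-∧⁺ (subst T (allFin-cong hₜ≡gₜ) (T-∧ˡ u))
                    (subst T mult-eq (T-∧ʳ {allFin (λ t → h t (lookup (∪ᵗ D I) t))} u))
        from : T (allFin (λ t → g t (lookup I t)) ∧ (multiplicity I ≡ᵥᵇ α)) →
               T (allFin (λ t → h t (lookup (∪ᵗ D I) t)) ∧ (multiplicity (∪ᵗ D I) ≡ᵥᵇ β))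
        from u = T-∧⁺ (subst T (sym (allFin-cong hₜ≡gₜ)) (T-∧ˡ u))
                      (subst T (sym mult-eq) (T-∧ʳ {allFin (λ t → g t (lookup I t))} u))
      ... | false with allFin (λ t → g t (lookup I t)) ∧ (multiplicity I ≡ᵥᵇ α) in e
      ...   | false = refl
      ...   | true  = ⊥-elim (subst T disj (allDisjointᵇ-complete I D (λ t → disjointᵇ-complete (lookup I t) D (λ x x∈Iₜ x∈D →
                ∣p∣≡0⇒∉ (column x I) t
                  (trans (∣column∣≡multiplicity x I)
                    (trans (≡ᵥᵇ-sound (multiplicity I) α (T-∧ʳ {allFin (λ t → g t (lookup I t))} (≡true⇒T e)) x) (α|D≡0 x x∈D)))
                  (subst T (sym (lookup-column x I t)) x∈Iₜ)))))

    ∑-strip : ∑ (allVecs m (allSubsets n))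
                (λ S → 𝟙 (allFin (λ t → h t (lookup S t)) ∧ (multiplicity S ≡ᵥᵇ tabulate (λ x → lookup α x + m * 𝟙 (lookup D x)))))
            ≡ ∑ (allVecs m (allSubsets n)) (λ I → 𝟙 (allFin (λ t → g t (lookup I t)) ∧ (multiplicity I ≡ᵥᵇ α)))
    ∑-strip = trans (∑-⊇ᵗ m D F F-⊇D) (∑-cong (allVecs m (allSubsets n)) F∘∪ᵗ≡G)

  -- Independence in M[X, (1, …, p-1)]

  lookup²∘tabulate² : ∀ {A : Set} {n c} (F : Fin n → Fin c → A) x j →
    lookup (lookup (tabulate λ x → tabulate (F x)) x) j ≡ F x j
  lookup²∘tabulate² F x j = trans (cong (λ r → lookup r j) (lookup∘tabulate (λ x → tabulate (F x)) x)) (lookup∘tabulate (F x) j)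

  module Contraction {n p′ : ℕ} (M : Matroid n) (X : Vec (Subset n) (suc p′)) (X-disjoint : PairwiseDisjoint X) where
    open Bases M

    p : ℕ
    p = suc p′

    ⋃X  = unionX M X
    Xₚ  = lastBlock M X
    G₂  = ground₂ M X p qStd
    G₃  = ground₃ M X p qStd
    C   = contrSet M X p qStd
    support = proj M X p qStd
    I₂  = indep₂ M X p qStd
    I₃  = indep₃ M X p qStd
    isBasisᵇ = isBasisC M X p qStd

    Xᵢ-disjoint : ∀ i i′ x → ¬ i ≡ i′ → T (lookup (lookup X i) x) → ¬ T (lookup (lookup X i′) x)
    Xᵢ-disjoint i i′ x ne a b = X-disjoint i i′ x ne (T⇒∈ a) (T⇒∈ b)

    Xₚ-sound : ∀ x → T (lookup Xₚ x) → ∃ λ i → T (isLast M X i) × T (lookup (lookup X i) x)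
    Xₚ-sound x t with anyFin-sound (λ i → isLast M X i ∧ lookup (lookup X i) x)
                        (subst T (lookup∘tabulate (λ x → anyFin (λ i → isLast M X i ∧ lookup (lookup X i) x)) x) t)
    ... | i , u = i , T-∧ˡ u , T-∧ʳ {isLast M X i} u

    Xₚ⊆⋃X : ∀ x → T (lookup Xₚ x) → T (lookup ⋃X x)
    Xₚ⊆⋃X x t = let (i , _ , m) = Xₚ-sound x t in ⋃-complete X x i m

    lookup-G₂ : ∀ x j → lookup (lookup G₂ x) j ≡ (lookup ⋃X x ∧ ((toℕ j ≡ᵇ 0) ∨
                  anyFin (λ i → not (isLast M X i) ∧ lookup (lookup X i) x ∧ (toℕ j <ᵇ qStd i))))
    lookup-G₂ = lookup²∘tabulate² _

    lookup-C : ∀ x j → lookup (lookup C x) j ≡ (lookup Xₚ x ∧ (toℕ j ≡ᵇ 0))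
    lookup-C = lookup²∘tabulate² _

    lookup-G₃ : ∀ x j → lookup (lookup G₃ x) j ≡ (lookup (lookup G₂ x) j ∧ not (lookup (lookup C x) j))
    lookup-G₃ = lookup²∘tabulate² _

    G₂⊆⋃X : ∀ x j → Mem G₂ x j → T (lookup ⋃X x)
    G₂⊆⋃X x j m = T-∧ˡ (subst T (lookup-G₂ x j) m)

    G₃⊆G₂ : ∀ x j → Mem G₃ x j → Mem G₂ x j
    G₃⊆G₂ x j m = T-∧ˡ (subst T (lookup-G₃ x j) m)

    C-sound : ∀ x j → Mem C x j → T (lookup Xₚ x) × toℕ j ≡ 0
    C-sound x j m = T-∧ˡ (subst T (lookup-C x j) m) , ≡ᵇ⇒≡ _ _ (T-∧ʳ {lookup Xₚ x} (subst T (lookup-C x j) m))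

    C-complete : ∀ x j → T (lookup Xₚ x) → toℕ j ≡ 0 → Mem C x j
    C-complete x j a e = subst T (sym (lookup-C x j)) (T-∧⁺ a (subst (λ w → T (w ≡ᵇ 0)) (sym e) _))

    C⊆G₂ : ∀ x j → Mem C x j → Mem G₂ x j
    C⊆G₂ x j m with C-sound x j m
    ... | a , e = subst T (sym (lookup-G₂ x j)) (T-∧⁺ (Xₚ⊆⋃X x a) (T-∨ˡ (subst (λ w → T (w ≡ᵇ 0)) (sym e) _)))

    -- Elements of X_p are not multiplied, so their only copy is contracted.
    Xₚ-∉G₃ : ∀ x j → T (lookup Xₚ x) → ¬ Mem G₃ x j
    Xₚ-∉G₃ x j x∈Xₚ m with subst T (lookup-G₃ x j) m
    ... | m′ with toℕ j ≡ᵇ 0 in j≡0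
    ...   | true = T-not⁻ {lookup (lookup C x) j} (T-∧ʳ {lookup (lookup G₂ x) j} m′)
                     (C-complete x j x∈Xₚ (≡ᵇ⇒≡ _ _ (≡true⇒T j≡0)))
    ...   | false with T-∨⁻ {toℕ j ≡ᵇ 0} (T-∧ʳ {lookup ⋃X x} (subst T (lookup-G₂ x j) (T-∧ˡ m′)))
    ...     | inj₁ z = subst T j≡0 z
    ...     | inj₂ a with anyFin-sound _ a | Xₚ-sound x x∈Xₚ
    ...       | i , u | i′ , last-i′ , x∈Xᵢ′ = Xᵢ-disjoint i′ i x i′≢i x∈Xᵢ′ (T-∧ˡ (T-∧ʳ {not (isLast M X i)} u))
      where
      i′≢i : ¬ i′ ≡ i
      i′≢i refl = T-not⁻ {isLast M X i′} (T-∧ˡ u) last-i′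

    support-sound : ∀ S x → T (lookup (support S) x) → ∃ λ j → Mem S x j
    support-sound S x t = ∣p∣≢0⇒∈ (lookup S x) (subst T (lookup-map x _ S) t)

    support-complete : ∀ S x j → Mem S x j → T (lookup (support S) x)
    support-complete S x j m = subst T (sym (lookup-map x _ S)) (∈⇒∣p∣≢0 (lookup S x) j m)

    record Indep₂ (S : USub n p) : Set where
      field
        ⊆G₂         : ∀ x j → Mem S x j → Mem G₂ x j
        atMostOneCopy : ∀ x → T (∣ lookup S x ∣ <ᵇ 2)
        support⊆⋃X  : ∀ x → T (lookup (support S) x) → T (lookup ⋃X x)
        independent : Independent (support S)

    indep₂-sound : ∀ S → T (I₂ S) → Indep₂ S
    indep₂-sound S t = record
      { ⊆G₂ = ⊆Uᵇ-sound S G₂ (T-∧ˡ t)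
      ; atMostOneCopy = all<2ᵇ-sound ∣_∣ S (T-∧ˡ t₂)
      ; support⊆⋃X = ⊆ᵇ-sound (support S) ⋃X (T-∧ˡ t₃)
      ; independent = T-∧ʳ {support S ⊆ᵇ ⋃X} t₃ }
      where
      t₂ = T-∧ʳ {S ⊆Uᵇ G₂} t
      t₃ = T-∧ʳ {noTwoCopies M X p qStd S} t₂

    indep₂-complete : ∀ S → Indep₂ S → T (I₂ S)
    indep₂-complete S I = T-∧⁺ (⊆Uᵇ-complete S G₂ ⊆G₂)
      (T-∧⁺ (all<2ᵇ-complete ∣_∣ S atMostOneCopy) (T-∧⁺ (⊆ᵇ-complete (support S) ⋃X support⊆⋃X) independent))
      where open Indep₂ I

    copy₀ : Subset n → USub n p
    copy₀ b = tabulate λ x → tabulate λ j → lookup b x ∧ (toℕ j ≡ᵇ 0)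

    lookup-copy₀ : ∀ b x j → lookup (lookup (copy₀ b) x) j ≡ (lookup b x ∧ (toℕ j ≡ᵇ 0))
    lookup-copy₀ b = lookup²∘tabulate² (λ x j → lookup b x ∧ (toℕ j ≡ᵇ 0))

    copy₀-sound : ∀ b x j → Mem (copy₀ b) x j → T (lookup b x) × toℕ j ≡ 0
    copy₀-sound b x j m = T-∧ˡ m′ , ≡ᵇ⇒≡ _ _ (T-∧ʳ {lookup b x} m′)
      where m′ = subst T (lookup-copy₀ b x j) m

    copy₀-complete : ∀ b x j → T (lookup b x) → toℕ j ≡ 0 → Mem (copy₀ b) x j
    copy₀-complete b x j a e = subst T (sym (lookup-copy₀ b x j)) (T-∧⁺ a (subst (λ w → T (w ≡ᵇ 0)) (sym e) _))

    copy₀-indep₂ : ∀ b → b ⊆ Xₚ → Independent b → T (I₂ (copy₀ b))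
    copy₀-indep₂ b b⊆Xₚ ib = indep₂-complete (copy₀ b) (record
      { ⊆G₂ = λ y j m → C⊆G₂ y j (in-C y j m)
      ; atMostOneCopy = λ y → ⊆⁅0⁆⇒∣p∣<2 (lookup (copy₀ b) y) (λ j m → proj₂ (copy₀-sound b y j m))
      ; support⊆⋃X = λ y u → let (j , m) = support-sound (copy₀ b) y u in Xₚ⊆⋃X y (proj₁ (C-sound y j (in-C y j m)))
      ; independent = indep-down M support⊆b ib })
      where
      in-C : ∀ y j → Mem (copy₀ b) y j → Mem C y j
      in-C y j m = let (u , e) = copy₀-sound b y j m in C-complete y j (∈⇒T (b⊆Xₚ (T⇒∈ u))) e
      support⊆b : support (copy₀ b) ⊆ b
      support⊆b {y} y∈ = let (j , m) = support-sound (copy₀ b) y (∈⇒T y∈) in T⇒∈ (proj₁ (copy₀-sound b y j m))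

    -- Adding the 0-th copy of x to B stays inside C and independent, so maximality of B forces it into B.
    isBasisᵇ-maximal : ∀ B → T (isBasisᵇ B) → ∀ {x} → x ∈ Xₚ → x ∉ support B → ¬ Independent (⁅ x ⁆ ∪ support B)
    isBasisᵇ-maximal B t {x} x∈Xₚ x∉ ind = x∉ (T⇒∈ (support-complete B x fz x₀∈B))
      where
      B⊆C = T-∧ˡ t
      noLarger = T-∧ʳ {I₂ B} (T-∧ʳ {B ⊆Uᵇ C} t)
      B′ = B ∪U copy₀ ⁅ x ⁆
      B′⊆C : ∀ y j → Mem B′ y j → Mem C y j
      B′⊆C y j m with Mem-∪U⁻ B (copy₀ ⁅ x ⁆) y j m
      ... | inj₁ a = ⊆Uᵇ-sound B C B⊆C y j a
      ... | inj₂ b with copy₀-sound ⁅ x ⁆ y j b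
      ...   | u , e rewrite x∈⁅y⁆⇒x≡y x (T⇒∈ u) = C-complete x j (∈⇒T x∈Xₚ) e
      support-B′ : support B′ ⊆ (⁅ x ⁆ ∪ support B)
      support-B′ {y} y∈ with support-sound B′ y (∈⇒T y∈)
      ... | j , m with Mem-∪U⁻ B (copy₀ ⁅ x ⁆) y j m
      ...   | inj₁ a = x∈p∪q⁺ (inj₂ (T⇒∈ (support-complete B y j a)))
      ...   | inj₂ b = x∈p∪q⁺ (inj₁ (T⇒∈ (proj₁ (copy₀-sound ⁅ x ⁆ y j b))))
      I₂B′ : T (I₂ B′)
      I₂B′ = indep₂-complete B′ (record
        { ⊆G₂ = λ y j m → C⊆G₂ y j (B′⊆C y j m)
        ; atMostOneCopy = λ y → ⊆⁅0⁆⇒∣p∣<2 (lookup B′ y) (λ j m → proj₂ (C-sound y j (B′⊆C y j m)))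
        ; support⊆⋃X = λ y u → let (j , m) = support-sound B′ y u in Xₚ⊆⋃X y (proj₁ (C-sound y j (B′⊆C y j m)))
        ; independent = indep-down M support-B′ ind })
      larger : T ((B ⊆Uᵇ B′) ∧ (B′ ⊆Uᵇ C) ∧ I₂ B′)
      larger = T-∧⁺ (⊆Uᵇ-complete B B′ (λ y j m → Mem-∪Uˡ B (copy₀ ⁅ x ⁆) y j m)) (T-∧⁺ (⊆Uᵇ-complete B′ C B′⊆C) I₂B′)
      B≡B′ : T (B ≡Uᵇ B′)
      B≡B′ with T-∨⁻ (all-sound (λ B′ → not ((B ⊆Uᵇ B′) ∧ (B′ ⊆Uᵇ C) ∧ I₂ B′) ∨ (B ≡Uᵇ B′))
                        (allUSub n p) noLarger (∈-allVecs ∈-allSubsets B′))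
      ... | inj₁ ¬larger = ⊥-elim (T-not⁻ ¬larger larger)
      ... | inj₂ e = e
      x₀∈B : Mem B x fz
      x₀∈B = ⊆Uᵇ-sound B′ B (T-∧ʳ {B ⊆Uᵇ B′} B≡B′) x fz
               (Mem-∪Uʳ B (copy₀ ⁅ x ⁆) x fz (copy₀-complete ⁅ x ⁆ x fz (∈⇒T (x∈⁅x⁆ x)) refl))

    isBasisᵇ⇒IsBasis : ∀ B → T (isBasisᵇ B) → IsBasis Xₚ (support B)
    isBasisᵇ⇒IsBasis B t = support⊆Xₚ , Indep₂.independent (indep₂-sound B (T-∧ˡ (T-∧ʳ {B ⊆Uᵇ C} t))) , isBasisᵇ-maximal B t
      where
      support⊆Xₚ : support B ⊆ Xₚ
      support⊆Xₚ {y} y∈ with support-sound B y (∈⇒T y∈)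
      ... | j , m = T⇒∈ (proj₁ (C-sound y j (⊆Uᵇ-sound B C (T-∧ˡ t) y j m)))

    indep₃⇒atMostOneCopy : ∀ S → T (I₃ S) → ∀ x → T (∣ lookup S x ∣ <ᵇ 2)
    indep₃⇒atMostOneCopy S t x with any-sound (λ B → isBasisᵇ B ∧ I₂ (S ∪U B)) (allUSub n p) (T-∧ʳ {S ⊆Uᵇ G₃} t)
    ... | B , _ , u =
      <ᵇ2-mono _ _ (subst (∣ lookup S x ∣ ≤_) (cong ∣_∣ (sym (lookup-zipWith _∪_ x S B))) (∣p∣≤∣p∪q∣ (lookup S x) (lookup B x)))
        (Indep₂.atMostOneCopy (indep₂-sound (S ∪U B) (T-∧ʳ {isBasisᵇ B} u)) x)

    cardU≡∣support∣ : ∀ {m} (S : USub m p) → (∀ x → T (∣ lookup S x ∣ <ᵇ 2)) →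
      cardU S ≡ ∣ V.map (λ row → not (∣ row ∣ ≡ᵇ 0)) S ∣
    cardU≡∣support∣ []      f = refl
    cardU≡∣support∣ (r ∷ S) f with ∣ r ∣ | f fz
    ... | zero     | _ = cardU≡∣support∣ S (λ x → f (fs x))
    ... | suc zero | _ = cong suc (cardU≡∣support∣ S (λ x → f (fs x)))

    supports : Vec (USub n p) p → Vec (Subset n) p
    supports A = V.map support A

    _≡ᵗᵇ_ : (u v : Vec (Subset n) p) → Bool
    u ≡ᵗᵇ v = ⌊ VP.≡-dec (VP.≡-dec _≟ᴮ_) u v ⌋

    ≡ᵗᵇ-sound : ∀ u v → T (u ≡ᵗᵇ v) → u ≡ v
    ≡ᵗᵇ-sound u v = toWitness {a? = VP.≡-dec (VP.≡-dec _≟ᴮ_) u v}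

    ≡ᵗᵇ-complete : ∀ u v → u ≡ v → T (u ≡ᵗᵇ v)
    ≡ᵗᵇ-complete u v = fromWitness {a? = VP.≡-dec (VP.≡-dec _≟ᴮ_) u v}

    distributesAllᵇ : Vec (Subset n) p → Vec (USub n p) p → Bool
    distributesAllᵇ I A = allFin (λ x → distributesᵇ (column x I) (lookup G₃ x) (column x A))

    column⁺ : ∀ x (A : Vec (USub n p) p) t j → Mem (lookup A t) x j → T (lookup (lookup (column x A) t) j)
    column⁺ x A t j = subst (λ r → T (lookup r j)) (sym (lookup-column x A t))

    column⁻ : ∀ x (A : Vec (USub n p) p) t j → T (lookup (lookup (column x A) t) j) → Mem (lookup A t) x j
    column⁻ x A t j = subst (λ r → T (lookup r j)) (lookup-column x A t)

    partition⇒distributes : ∀ A → OrderedPartition G₃ A → (∀ s x → T (∣ lookup (lookup A s) x ∣ <ᵇ 2)) →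
      ∀ x → Distributes (column x (supports A)) (lookup G₃ x) (column x A)
    partition⇒distributes A P one x = record
      { fits = fits
      ; disjoint = λ s u ne j a b → disjoint s u ne x j (column⁻ x A s j a) (column⁻ x A u j b)
      ; covers = λ j m → let (u , y) = covers x j m in u , column⁺ x A u j y
      ; inside = λ u j y → inside u x j (column⁻ x A u j y) }
      where
      open OrderedPartition P
      fits : ∀ t → T (rowFits (lookup (column x (supports A)) t) (lookup (column x A) t))
      fits t rewrite lookup-column x (supports A) t | lookup-column x A t | lookup-map t support A =
        rowFits-complete _ (lookup (lookup A t) x) (sym (lookup-map x _ (lookup A t))) (one t x)

    α′ : Vec ℕ n
    α′ = V.map ∣_∣ G₃

    W : ℕ
    W = ∏ (λ x → ∣ lookup G₃ x ∣ !)

    instance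
      W-nonZero : NonZero W
      W-nonZero = ∏-nonZero (λ x → ∣ lookup G₃ x ∣ !) (λ x → ∣ lookup G₃ x ∣ !≢0)

    ∑-distributesAllᵇ : ∀ I → ∑ (allVecs p (allUSub n p)) (λ A → 𝟙 (distributesAllᵇ I A)) ≡ W * 𝟙 (multiplicity I ≡ᵥᵇ α′)
    ∑-distributesAllᵇ I = begin
        ∑ (allVecs p (allVecs n (allSubsets p))) (λ A → 𝟙 (distributesAllᵇ I A))
      ≡⟨ ∑-cong (allVecs p (allVecs n (allSubsets p))) (λ A → 𝟙-allFin (λ x → d x (column x A))) ⟩
        ∑ (allVecs p (allVecs n (allSubsets p))) (λ A → ∏ (λ x → 𝟙 (d x (column x A))))
      ≡⟨ ∑-columns (allSubsets p) p n _ ⟩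
        ∑ (allVecs n Rows) (λ B → ∏ (λ x → 𝟙 (d x (column x (columns B)))))
      ≡⟨ ∑-cong (allVecs n Rows) (λ B → ∏-cong (λ x → cong (λ R → 𝟙 (d x R)) (column-columns x B))) ⟩
        ∑ (allVecs n Rows) (λ B → ∏ (λ x → 𝟙 (d x (lookup B x))))
      ≡⟨ ∑-allVecs-∏ Rows n (λ x R → 𝟙 (d x R)) ⟩
        ∏ (λ x → ∑ Rows (λ R → 𝟙 (d x R)))
      ≡⟨ ∏-cong (λ x → ∑-distributesᵇ (column x I) (lookup G₃ x)) ⟩
        ∏ (λ x → (∣ column x I ∣ !) * 𝟙 (∣ column x I ∣ ≡ᵇ ∣ lookup G₃ x ∣))
      ≡⟨ ∏-cong (λ x → trans (!*𝟙≡ᵇ ∣ column x I ∣ ∣ lookup G₃ x ∣)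
                            (cong (λ c → (∣ lookup G₃ x ∣ !) * 𝟙 (c ≡ᵇ ∣ lookup G₃ x ∣)) (∣column∣≡multiplicity x I))) ⟩
        ∏ (λ x → (∣ lookup G₃ x ∣ !) * 𝟙 (lookup (multiplicity I) x ≡ᵇ ∣ lookup G₃ x ∣))
      ≡⟨ ∏-* (λ x → ∣ lookup G₃ x ∣ !) _ ⟩
        W * ∏ (λ x → 𝟙 (lookup (multiplicity I) x ≡ᵇ ∣ lookup G₃ x ∣))
      ≡⟨ cong (W *_) (sym (𝟙-allFin (λ x → lookup (multiplicity I) x ≡ᵇ ∣ lookup G₃ x ∣))) ⟩
        W * 𝟙 (allFin (λ x → lookup (multiplicity I) x ≡ᵇ ∣ lookup G₃ x ∣))
      ≡⟨ cong (λ b → W * 𝟙 b) (trans (allFin-cong (λ x → cong (lookup (multiplicity I) x ≡ᵇ_) (sym (lookup-map x ∣_∣ G₃))))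
                                       (allFin-≡ᵇ≡≡ᵥᵇ (multiplicity I) α′)) ⟩
        W * 𝟙 (multiplicity I ≡ᵥᵇ α′)
      ∎
      where
      open ≡-Reasoning
      Rows = allVecs p (allSubsets p)
      d : Fin n → Vec (Subset p) p → Bool
      d x = distributesᵇ (column x I) (lookup G₃ x)

    module WithBasis (b₀ : Subset n) (b₀-basis : IsBasis Xₚ b₀) where
      B₀ = copy₀ b₀
      b₀⊆Xₚ = proj₁ b₀-basis
      b₀-maximal = proj₂ (proj₂ b₀-basis)

      B₀⊆C : ∀ y j → Mem B₀ y j → Mem C y j
      B₀⊆C y j m = let (u , e) = copy₀-sound b₀ y j m in C-complete y j (∈⇒T (b₀⊆Xₚ (T⇒∈ u))) e

      isBasisᵇ-B₀ : T (isBasisᵇ B₀)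
      isBasisᵇ-B₀ = T-∧⁺ (⊆Uᵇ-complete B₀ C B₀⊆C)
        (T-∧⁺ (copy₀-indep₂ b₀ b₀⊆Xₚ (proj₁ (proj₂ b₀-basis))) (all-complete _ (allUSub n p) (λ B′ _ → noLarger B′)))
        where
        noLarger : ∀ B′ → T (not ((B₀ ⊆Uᵇ B′) ∧ (B′ ⊆Uᵇ C) ∧ I₂ B′) ∨ (B₀ ≡Uᵇ B′))
        noLarger B′ with (B₀ ⊆Uᵇ B′) ∧ (B′ ⊆Uᵇ C) ∧ I₂ B′ in e
        ... | false = _
        ... | true  = T-∧⁺ B₀⊆B′ (⊆Uᵇ-complete B′ B₀ B′⊆B₀)
          where
          larger = ≡true⇒T e
          B₀⊆B′ = T-∧ˡ larger
          B′⊆C = T-∧ˡ (T-∧ʳ {B₀ ⊆Uᵇ B′} larger)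
          I₂B′ = T-∧ʳ {B′ ⊆Uᵇ C} (T-∧ʳ {B₀ ⊆Uᵇ B′} larger)
          B′⊆B₀ : ∀ y j → Mem B′ y j → Mem B₀ y j
          B′⊆B₀ y j m with C-sound y j (⊆Uᵇ-sound B′ C B′⊆C y j m)
          ... | y∈Xₚ , j≡0 with y ∈? b₀
          ...   | yes y∈b₀ = copy₀-complete b₀ y j (∈⇒T y∈b₀) j≡0
          ...   | no  y∉b₀ =
            ⊥-elim (b₀-maximal (T⇒∈ y∈Xₚ) y∉b₀ (indep-down M y∪b₀⊆ (Indep₂.independent (indep₂-sound B′ I₂B′))))
            where
            y∪b₀⊆ : (⁅ y ⁆ ∪ b₀) ⊆ support B′
            y∪b₀⊆ {z} z∈ with x∈p∪q⁻ ⁅ y ⁆ b₀ z∈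
            ... | inj₁ z≡y rewrite x∈⁅y⁆⇒x≡y y z≡y = T⇒∈ (support-complete B′ y j m)
            ... | inj₂ z∈b₀ =
              T⇒∈ (support-complete B′ z fz (⊆Uᵇ-sound B₀ B′ B₀⊆B′ z fz (copy₀-complete b₀ z fz (∈⇒T z∈b₀) refl)))

      -- Independence in the contraction may be tested against any basis of X_p, in particular b₀.
      indep₃⇒independent-∪b₀ : ∀ S → T (I₃ S) → Independent (support S ∪ b₀)
      indep₃⇒independent-∪b₀ S t with any-sound (λ B → isBasisᵇ B ∧ I₂ (S ∪U B)) (allUSub n p) (T-∧ʳ {S ⊆Uᵇ G₃} t)
      ... | B , _ , u = ∪-basis-swap {support S} {Xₚ} {support B} {b₀} S∩Xₚ≡∅ (isBasisᵇ⇒IsBasis B (T-∧ˡ u)) b₀-basis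
                          (indep-down M S∪B⊆ (Indep₂.independent (indep₂-sound (S ∪U B) (T-∧ʳ {isBasisᵇ B} u))))
        where
        S⊆G₃ = ⊆Uᵇ-sound S G₃ (T-∧ˡ t)
        S∩Xₚ≡∅ : ∀ {x} → x ∈ support S → x ∉ Xₚ
        S∩Xₚ≡∅ {x} x∈ x∈Xₚ = let (j , m) = support-sound S x (∈⇒T x∈) in Xₚ-∉G₃ x j (∈⇒T x∈Xₚ) (S⊆G₃ x j m)
        S∪B⊆ : (support S ∪ support B) ⊆ support (S ∪U B)
        S∪B⊆ {z} z∈ with x∈p∪q⁻ (support S) (support B) z∈
        ... | inj₁ a = let (j , m) = support-sound S z (∈⇒T a) in T⇒∈ (support-complete (S ∪U B) z j (Mem-∪Uˡ S B z j m))
        ... | inj₂ a = let (j , m) = support-sound B z (∈⇒T a) in T⇒∈ (support-complete (S ∪U B) z j (Mem-∪Uʳ S B z j m))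

      independent-∪b₀⇒indep₃ : ∀ S → (∀ x j → Mem S x j → Mem G₃ x j) → (∀ x → T (∣ lookup S x ∣ <ᵇ 2)) →
        Independent (support S ∪ b₀) → T (I₃ S)
      independent-∪b₀⇒indep₃ S S⊆G₃ one ind = T-∧⁺ (⊆Uᵇ-complete S G₃ S⊆G₃)
        (any-complete (λ B → isBasisᵇ B ∧ I₂ (S ∪U B)) (allUSub n p) (∈-allVecs ∈-allSubsets B₀)
          (T-∧⁺ isBasisᵇ-B₀ (indep₂-complete (S ∪U B₀) I₂-S∪B₀)))
        where
        S∪B₀⊆G₂ : ∀ y j → Mem (S ∪U B₀) y j → Mem G₂ y j
        S∪B₀⊆G₂ y j m with Mem-∪U⁻ S B₀ y j m
        ... | inj₁ a = G₃⊆G₂ y j (S⊆G₃ y j a)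
        ... | inj₂ b = C⊆G₂ y j (B₀⊆C y j b)
        one′ : ∀ y → T (∣ lookup (S ∪U B₀) y ∣ <ᵇ 2)
        one′ y with y ∈? Xₚ
        ... | yes y∈Xₚ = ⊆⁅0⁆⇒∣p∣<2 (lookup (S ∪U B₀) y) (λ j m → only-copy₀ (Mem-∪U⁻ S B₀ y j m))
          where
          only-copy₀ : ∀ {j} → Mem S y j ⊎ Mem B₀ y j → toℕ j ≡ 0
          only-copy₀ {j} (inj₁ a) = ⊥-elim (Xₚ-∉G₃ y j (∈⇒T y∈Xₚ) (S⊆G₃ y j a))
          only-copy₀ {j} (inj₂ b) = proj₂ (copy₀-sound b₀ y j b)
        ... | no y∉Xₚ rewrite lookup-zipWith _∪_ y S B₀
              | ∣p∣≡0⇒p≡⊥ (lookup B₀ y)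
                  (∉⇒∣p∣≡0 (lookup B₀ y) (λ j m → y∉Xₚ (b₀⊆Xₚ (T⇒∈ (proj₁ (copy₀-sound b₀ y j m))))))
              | ∪-identityʳ (lookup S y) = one y
        support⊆ : support (S ∪U B₀) ⊆ (support S ∪ b₀)
        support⊆ {z} z∈ with support-sound (S ∪U B₀) z (∈⇒T z∈)
        ... | j , m with Mem-∪U⁻ S B₀ z j m
        ...   | inj₁ a = x∈p∪q⁺ (inj₁ (T⇒∈ (support-complete S z j a)))
        ...   | inj₂ b = x∈p∪q⁺ (inj₂ (T⇒∈ (proj₁ (copy₀-sound b₀ z j b))))
        I₂-S∪B₀ : Indep₂ (S ∪U B₀)
        I₂-S∪B₀ = record
          { ⊆G₂ = S∪B₀⊆G₂
          ; atMostOneCopy = one′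
          ; support⊆⋃X = λ y u → let (j , m) = support-sound (S ∪U B₀) y u in G₂⊆⋃X y j (S∪B₀⊆G₂ y j m)
          ; independent = indep-down M support⊆ ind }

      extendsB₀ : ℤ → Subset n → Bool
      extendsB₀ z J = indep M (J ∪ b₀) ∧ ⌊ ℤ.+ ∣ J ∣ ℤ.≟ z ⌋

      module _ (is : Vec ℤ p) where
        countedᵇ : Vec (USub n p) p → Bool
        countedᵇ A = isOrderedPartition G₃ A ∧ allFin (λ s → I₃ (lookup A s) ∧ ⌊ ℤ.+ cardU (lookup A s) ℤ.≟ lookup is s ⌋)

        allExtendB₀ : Vec (Subset n) p → Bool
        allExtendB₀ I = allFin (λ s → extendsB₀ (lookup is s) (lookup I s))

        counted⇒distributes : ∀ A → T (countedᵇ A) → T (allExtendB₀ (supports A) ∧ distributesAllᵇ (supports A) A)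
        counted⇒distributes A t =
          T-∧⁺ (allFin-complete _ extends) (allFin-complete _ (λ x → distributesᵇ-complete _ _ _ (partition⇒distributes A P one x)))
          where
          P = isOrderedPartition-sound G₃ A (T-∧ˡ t)
          block : ∀ s → T (I₃ (lookup A s) ∧ ⌊ ℤ.+ cardU (lookup A s) ℤ.≟ lookup is s ⌋)
          block = allFin-sound _ (T-∧ʳ {isOrderedPartition G₃ A} t)
          one : ∀ s x → T (∣ lookup (lookup A s) x ∣ <ᵇ 2)
          one s = indep₃⇒atMostOneCopy (lookup A s) (T-∧ˡ (block s))
          extends : ∀ s → T (extendsB₀ (lookup is s) (lookup (supports A) s))
          extends s rewrite lookup-map s support A =
            T-∧⁺ (indep₃⇒independent-∪b₀ (lookup A s) (T-∧ˡ (block s)))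
                 (subst (λ w → T ⌊ ℤ.+ w ℤ.≟ lookup is s ⌋) (cardU≡∣support∣ (lookup A s) (one s)) (T-∧ʳ {I₃ (lookup A s)} (block s)))

        distributes⇒counted : ∀ I A → T (allExtendB₀ I ∧ distributesAllᵇ I A) → supports A ≡ I × T (countedᵇ A)
        distributes⇒counted I A t =
          supports≡I , T-∧⁺ (isOrderedPartition-complete G₃ A P) (allFin-complete _ (λ s → T-∧⁺ (indep₃-block s) (card s)))
          where
          extends : ∀ s → T (extendsB₀ (lookup is s) (lookup I s))
          extends = allFin-sound _ (T-∧ˡ t)
          D : ∀ x → Distributes (column x I) (lookup G₃ x) (column x A)
          D x = distributesᵇ-sound _ _ _ (allFin-sound _ (T-∧ʳ {allExtendB₀ I} t) x)
          fits : ∀ s x → (not (∣ lookup (lookup A s) x ∣ ≡ᵇ 0) ≡ lookup (lookup I s) x) × T (∣ lookup (lookup A s) x ∣ <ᵇ 2)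
          fits s x with Distributes.fits (D x) s
          ... | r rewrite lookup-column x I s | lookup-column x A s = rowFits-sound (lookup (lookup I s) x) (lookup (lookup A s) x) r
          support≡ : ∀ s → support (lookup A s) ≡ lookup I s
          support≡ s = vec-ext (λ x → trans (lookup-map x _ (lookup A s)) (proj₁ (fits s x)))
          supports≡I : supports A ≡ I
          supports≡I = vec-ext (λ s → trans (lookup-map s support A) (support≡ s))
          P : OrderedPartition G₃ A
          P = record
            { disjoint = λ s u ne x j a b → Distributes.disjoint (D x) s u ne j (column⁺ x A s j a) (column⁺ x A u j b)
            ; covers = λ x j m → let (u , y) = Distributes.covers (D x) j m in u , column⁻ x A u j y
            ; inside = λ u x j m → Distributes.inside (D x) u j (column⁺ x A u j m) }
          indep₃-block : ∀ s → T (I₃ (lookup A s))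
          indep₃-block s = independent-∪b₀⇒indep₃ (lookup A s) (OrderedPartition.inside P s) (λ x → proj₂ (fits s x))
            (subst (λ w → Independent (w ∪ b₀)) (sym (support≡ s)) (T-∧ˡ (extends s)))
          card : ∀ s → T ⌊ ℤ.+ cardU (lookup A s) ℤ.≟ lookup is s ⌋
          card s = subst (λ w → T ⌊ ℤ.+ w ℤ.≟ lookup is s ⌋)
            (sym (trans (cardU≡∣support∣ (lookup A s) (λ x → proj₂ (fits s x))) (cong ∣_∣ (support≡ s))))
            (T-∧ʳ {indep M (lookup I s ∪ b₀)} (extends s))

        -- The blocks of a partition of N determine a tuple of subsets of E (their supports);
        -- conversely such a tuple is lifted by distributing the copies of each x over the blocks containing x.
        counted≡distributes : ∀ I A → 𝟙 ((supports A ≡ᵗᵇ I) ∧ countedᵇ A) ≡ 𝟙 (allExtendB₀ I ∧ distributesAllᵇ I A)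
        counted≡distributes I A = cong 𝟙 (T-ext to from)
          where
          to : T ((supports A ≡ᵗᵇ I) ∧ countedᵇ A) → T (allExtendB₀ I ∧ distributesAllᵇ I A)
          to t = subst (λ I → T (allExtendB₀ I ∧ distributesAllᵇ I A)) (≡ᵗᵇ-sound (supports A) I (T-∧ˡ t))
                   (counted⇒distributes A (T-∧ʳ {supports A ≡ᵗᵇ I} t))
          from : T (allExtendB₀ I ∧ distributesAllᵇ I A) → T ((supports A ≡ᵗᵇ I) ∧ countedᵇ A)
          from t = let (eq , c) = distributes⇒counted I A t in T-∧⁺ (≡ᵗᵇ-complete (supports A) I eq) c

        ∑-allExtendB₀∧distributes : ∀ I → ∑ (allVecs p (allUSub n p)) (λ A → 𝟙 (allExtendB₀ I ∧ distributesAllᵇ I A))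
                                      ≡ W * 𝟙 (allExtendB₀ I ∧ (multiplicity I ≡ᵥᵇ α′))
        ∑-allExtendB₀∧distributes I = begin
            ∑ As (λ A → 𝟙 (allExtendB₀ I ∧ distributesAllᵇ I A))
          ≡⟨ ∑-cong As (λ A → 𝟙-∧ (allExtendB₀ I) (distributesAllᵇ I A)) ⟩
            ∑ As (λ A → 𝟙 (allExtendB₀ I) * 𝟙 (distributesAllᵇ I A))
          ≡⟨ ∑-*ˡ As (𝟙 (allExtendB₀ I)) _ ⟩
            𝟙 (allExtendB₀ I) * ∑ As (λ A → 𝟙 (distributesAllᵇ I A))
          ≡⟨ cong (𝟙 (allExtendB₀ I) *_) (∑-distributesAllᵇ I) ⟩
            𝟙 (allExtendB₀ I) * (W * 𝟙 (multiplicity I ≡ᵥᵇ α′))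
          ≡⟨ x*[y*z]≡y*[x*z] (𝟙 (allExtendB₀ I)) W _ ⟩
            W * (𝟙 (allExtendB₀ I) * 𝟙 (multiplicity I ≡ᵥᵇ α′))
          ≡⟨ cong (W *_) (sym (𝟙-∧ (allExtendB₀ I) _)) ⟩
            W * 𝟙 (allExtendB₀ I ∧ (multiplicity I ≡ᵥᵇ α′))
          ∎
          where
          open ≡-Reasoning
          As = allVecs p (allUSub n p)
          x*[y*z]≡y*[x*z] : ∀ x y z → x * (y * z) ≡ y * (x * z)
          x*[y*z]≡y*[x*z] = solve-∀

        piCount≡W*∑ : piCount is (MXstd M X) ≡
          W * ∑ (allVecs p (allSubsets n)) (λ I → 𝟙 (allExtendB₀ I ∧ (multiplicity I ≡ᵥᵇ α′)))
        piCount≡W*∑ = begin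
            ∑ As (λ A → 𝟙 (countedᵇ A))
          ≡⟨ ∑-cong As (λ A → sym (∑-point-mass A)) ⟩
            ∑ As (λ A → ∑ Is (λ I → 𝟙 ((supports A ≡ᵗᵇ I) ∧ countedᵇ A)))
          ≡⟨ ∑-comm As Is _ ⟩
            ∑ Is (λ I → ∑ As (λ A → 𝟙 ((supports A ≡ᵗᵇ I) ∧ countedᵇ A)))
          ≡⟨ ∑-cong Is (λ I → ∑-cong As (counted≡distributes I)) ⟩
            ∑ Is (λ I → ∑ As (λ A → 𝟙 (allExtendB₀ I ∧ distributesAllᵇ I A)))
          ≡⟨ ∑-cong Is ∑-allExtendB₀∧distributes ⟩
            ∑ Is (λ I → W * 𝟙 (allExtendB₀ I ∧ (multiplicity I ≡ᵥᵇ α′)))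
          ≡⟨ ∑-*ˡ Is W _ ⟩
            W * ∑ Is (λ I → 𝟙 (allExtendB₀ I ∧ (multiplicity I ≡ᵥᵇ α′)))
          ∎
          where
          open ≡-Reasoning
          As = allVecs p (allUSub n p)
          Is = allVecs p (allSubsets n)
          ∑-point-mass : ∀ A → ∑ Is (λ I → 𝟙 ((supports A ≡ᵗᵇ I) ∧ countedᵇ A)) ≡ 𝟙 (countedᵇ A)
          ∑-point-mass A =
            trans (enumerates-allVecs {xs = allSubsets n} (enumerates-allSubsets n) p (supports A) _
                     (λ I I≢ → cong (λ b → 𝟙 (b ∧ countedᵇ A)) (¬T⇒≡false (λ t → I≢ (sym (≡ᵗᵇ-sound (supports A) I t))))))
                  (cong (λ b → 𝟙 (b ∧ countedᵇ A)) (T⇒≡true (≡ᵗᵇ-complete (supports A) (supports A) refl)))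

      α′|b₀≡0 : ∀ x → T (lookup b₀ x) → lookup α′ x ≡ 0
      α′|b₀≡0 x x∈b₀ =
        trans (lookup-map x ∣_∣ G₃) (∉⇒∣p∣≡0 (lookup G₃ x) (λ j → Xₚ-∉G₃ x j (∈⇒T (b₀⊆Xₚ (T⇒∈ x∈b₀)))))

      β : Vec ℕ n
      β = tabulate (λ x → lookup α′ x + p * 𝟙 (lookup b₀ x))

      module _ (k l : ℤ) (l≡k+∣b₀∣ : l ≡ k ℤ.+ ℤ.+ ∣ b₀ ∣) where
        indepOfSize-∪b₀ : ∀ a J → T (disjointᵇ J b₀) → indepOfSize M (l ℤ.+ a) (J ∪ b₀) ≡ extendsB₀ (k ℤ.+ a) J
        indepOfSize-∪b₀ a J J∩b₀≡∅ = cong (indep M (J ∪ b₀) ∧_)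
          (trans (cong₂ (λ u w → ⌊ u ℤ.≟ w ⌋) ∣J∪b₀∣ l+a) (⌊≟⌋-cancelʳ (ℤ.+ ∣ J ∣) (k ℤ.+ a) (ℤ.+ ∣ b₀ ∣)))
          where
          ∣J∪b₀∣ : ℤ.+ ∣ J ∪ b₀ ∣ ≡ ℤ.+ ∣ J ∣ ℤ.+ ℤ.+ ∣ b₀ ∣
          ∣J∪b₀∣ = trans (cong ℤ.+_ (∣p∪q∣≡∣p∣+∣q∣ J b₀
                           (λ a b → disjointᵇ-sound J b₀ J∩b₀≡∅ _ (∈⇒T a) (∈⇒T b))))
                         (ℤP.pos-+ ∣ J ∣ ∣ b₀ ∣)
          l+a : l ℤ.+ a ≡ (k ℤ.+ a) ℤ.+ ℤ.+ ∣ b₀ ∣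
          l+a = trans (cong (ℤ._+ a) l≡k+∣b₀∣) (ring k (ℤ.+ ∣ b₀ ∣) a)
            where
            ring : ∀ k d a → (k ℤ.+ d) ℤ.+ a ≡ (k ℤ.+ a) ℤ.+ d
            ring = ℤRing.solve-∀

        piCount≡W*coefficient : (v : Vec ℤ p) →
          piCount (V.map (λ a → k ℤ.+ a) v) (MXstd M X) ≡ W * prodP (V.map (λ a → fpoly (l ℤ.+ a) M) v) β
        piCount≡W*coefficient v = begin
            piCount (V.map (λ a → k ℤ.+ a) v) (MXstd M X)
          ≡⟨ piCount≡W*∑ (V.map (λ a → k ℤ.+ a) v) ⟩
            W * ∑ Is (λ I → 𝟙 (allExtendB₀ (V.map (λ a → k ℤ.+ a) v) I ∧ (multiplicity I ≡ᵥᵇ α′)))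
          ≡⟨ cong (W *_) (sym (∑-strip b₀ α′ α′|b₀≡0 h g h∪b₀≡g)) ⟩
            W * ∑ Is (λ S → 𝟙 (allFin (λ t → h t (lookup S t)) ∧ (multiplicity S ≡ᵥᵇ β)))
          ≡⟨ cong (W *_) (sym (prodP-fpoly-coefficient M (λ a → l ℤ.+ a) v β)) ⟩
            W * prodP (V.map (λ a → fpoly (l ℤ.+ a) M) v) β
          ∎
          where
          open ≡-Reasoning
          Is = allVecs p (allSubsets n)
          h g : Fin p → Subset n → Bool
          h t = indepOfSize M (l ℤ.+ lookup v t)
          g t = extendsB₀ (lookup (V.map (λ a → k ℤ.+ a) v) t)
          h∪b₀≡g : ∀ t J → T (disjointᵇ J b₀) → h t (J ∪ b₀) ≡ g t J
          h∪b₀≡g t J d = trans (indepOfSize-∪b₀ (lookup v t) J d) (cong (λ z → extendsB₀ z J) (sym (lookup-map t (λ a → k ℤ.+ a) v)))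

  -- Realising an exponent vector as some β

  sum-zipWith-+ : ∀ {m} (u w : Vec ℕ m) → V.sum (V.zipWith _+_ u w) ≡ V.sum u + V.sum w
  sum-zipWith-+ []      []      = refl
  sum-zipWith-+ (a ∷ u) (b ∷ w) rewrite sum-zipWith-+ u w = interchange a b (V.sum u) (V.sum w)
    where
    interchange : ∀ a b c d → a + b + (c + d) ≡ a + c + (b + d)
    interchange = solve-∀

  sum-χ : ∀ {m} (J : Subset m) → V.sum (χ J) ≡ ∣ J ∣
  sum-χ []          = refl
  sum-χ (false ∷ J) = sum-χ J
  sum-χ (true ∷ J)  = cong suc (sum-χ J)

  sum-replicate-0 : ∀ m → V.sum (V.replicate m 0) ≡ 0
  sum-replicate-0 zero    = refl
  sum-replicate-0 (suc m) = sum-replicate-0 m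

  sum-multiplicity : ∀ {n m} (S : Vec (Subset n) m) → V.sum (multiplicity S) ≡ V.sum (V.map ∣_∣ S)
  sum-multiplicity {n} []  = sum-replicate-0 n
  sum-multiplicity (J ∷ S) = trans (sum-zipWith-+ (χ J) (multiplicity S)) (cong₂ _+_ (sum-χ J) (sum-multiplicity S))

  sum-+*χ : ∀ {m} (a b : Vec ℕ m) (c : ℕ) (D : Subset m) → (∀ x → lookup a x ≡ lookup b x + c * 𝟙 (lookup D x)) →
    V.sum a ≡ V.sum b + c * ∣ D ∣
  sum-+*χ []       []       c []      f = sym (*-zeroʳ c)
  sum-+*χ (a ∷ as) (b ∷ bs) c (d ∷ D) f rewrite f fz | sum-+*χ as bs c D (λ x → f (fs x)) = head d
    where
    ring₀ : ∀ b c s t → b + c * 0 + (s + c * t) ≡ b + s + c * t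
    ring₀ = solve-∀
    ring₁ : ∀ b c s t → b + c * 1 + (s + c * t) ≡ b + s + c * (1 + t)
    ring₁ = solve-∀
    head : ∀ d → b + c * 𝟙 d + (V.sum bs + c * ∣ D ∣) ≡ b + V.sum bs + c * ∣ d ∷ D ∣
    head false = ring₀ b c (V.sum bs) ∣ D ∣
    head true  = ring₁ b c (V.sum bs) ∣ D ∣

  sum-sizes : ∀ {n m} (l : ℤ) (S : Vec (Subset n) m) (v : Vec ℤ m) → (∀ t → ℤ.+ ∣ lookup S t ∣ ≡ l ℤ.+ lookup v t) →
    ℤ.+ V.sum (V.map ∣_∣ S) ≡ (ℤ.+ m) ℤ.* l ℤ.+ sumℤ v
  sum-sizes l []      []      f = refl
  sum-sizes {m = suc m} l (J ∷ S) (a ∷ v) f =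
    trans (ℤP.pos-+ ∣ J ∣ _) (trans (cong₂ ℤ._+_ (f fz) (sum-sizes l S v (λ t → f (fs t)))) (ring l a (ℤ.+ m) (sumℤ v)))
    where
    ring : ∀ l a m s → l ℤ.+ a ℤ.+ (m ℤ.* l ℤ.+ s) ≡ (ℤ.1ℤ ℤ.+ m) ℤ.* l ℤ.+ (a ℤ.+ s)
    ring = ℤRing.solve-∀

  -- X_i = {x : α_x = i} (blocks indexed from 1 in the paper, from 0 here).
  module Realisation {n p′ : ℕ} (M : Matroid n) (α : Vec ℕ n) where
    p : ℕ
    p = suc p′

    Xα : Vec (Subset n) p
    Xα = tabulate (λ i → tabulate (λ x → lookup α x ≡ᵇ suc (toℕ i)))

    lookup-Xα : ∀ i x → lookup (lookup Xα i) x ≡ (lookup α x ≡ᵇ suc (toℕ i))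
    lookup-Xα = lookup²∘tabulate² (λ i x → lookup α x ≡ᵇ suc (toℕ i))

    Xα-sound : ∀ i x → T (lookup (lookup Xα i) x) → lookup α x ≡ suc (toℕ i)
    Xα-sound i x t = ≡ᵇ⇒≡ _ _ (subst T (lookup-Xα i x) t)

    Xα-complete : ∀ i x → lookup α x ≡ suc (toℕ i) → T (lookup (lookup Xα i) x)
    Xα-complete i x e = subst T (sym (lookup-Xα i x)) (≡⇒≡ᵇ _ _ e)

    Xα-disjoint : PairwiseDisjoint Xα
    Xα-disjoint i j x i≢j a b = i≢j (toℕ-injective (suc-injective (trans (sym (Xα-sound i x (∈⇒T a))) (Xα-sound j x (∈⇒T b)))))

    open Contraction M Xα Xα-disjoint public hiding (p)

    Xₚ⇒α≡p : ∀ x → T (lookup Xₚ x) → lookup α x ≡ p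
    Xₚ⇒α≡p x t with Xₚ-sound x t
    ... | i , last , x∈Xᵢ = trans (Xα-sound i x x∈Xᵢ) (≡ᵇ⇒≡ _ _ last)

    α≡p⇒Xₚ : ∀ x → lookup α x ≡ p → T (lookup Xₚ x)
    α≡p⇒Xₚ x e = subst T (sym (lookup∘tabulate (λ x → anyFin (λ i → isLast M Xα i ∧ lookup (lookup Xα i) x)) x))
      (anyFin-complete _ (fromℕ p′)
        (T-∧⁺ (≡⇒≡ᵇ _ _ (cong suc (toℕ-fromℕ p′))) (Xα-complete (fromℕ p′) x (trans e (cong suc (sym (toℕ-fromℕ p′)))))))

    ∣G₃∣+p·𝟙Xₚ≡α : ∀ x → lookup α x ≤ p → ∣ lookup G₃ x ∣ + p * 𝟙 (lookup Xₚ x) ≡ lookup α x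
    ∣G₃∣+p·𝟙Xₚ≡α x α≤p with lookup α x ℕ.≟ p
    ... | yes α≡p rewrite T⇒𝟙≡1 (α≡p⇒Xₚ x α≡p)
                        | ∉⇒∣p∣≡0 (lookup G₃ x) (λ j → Xₚ-∉G₃ x j (α≡p⇒Xₚ x α≡p)) =
          trans (*-identityʳ p) (sym α≡p)
    ... | no α≢p rewrite ¬T⇒≡false {lookup Xₚ x} (λ t → α≢p (Xₚ⇒α≡p x t)) =
          trans (cong (∣ lookup G₃ x ∣ +_) (*-zeroʳ p))
                (trans (+-identityʳ _) (∣initial-segment∣ (lookup G₃ x) (lookup α x) α≤p below-α all-below-α))
      where
      below-α : ∀ j → T (lookup (lookup G₃ x) j) → toℕ j < lookup α x
      below-α j m with subst T (lookup-G₂ x j) (G₃⊆G₂ x j m)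
      ... | m₂ with ⋃-sound Xα x (T-∧ˡ m₂) | T-∨⁻ {toℕ j ≡ᵇ 0} (T-∧ʳ {lookup ⋃X x} m₂)
      ...   | i , x∈Xᵢ | inj₁ j≡0 rewrite Xα-sound i x x∈Xᵢ | ≡ᵇ⇒≡ (toℕ j) 0 j≡0 = s≤s z≤n
      ...   | i , x∈Xᵢ | inj₂ a with anyFin-sound _ a
      ...     | i′ , u rewrite Xα-sound i′ x (T-∧ˡ (T-∧ʳ {not (isLast M Xα i′)} u)) =
                <ᵇ⇒< (toℕ j) (suc (toℕ i′)) (T-∧ʳ {lookup (lookup Xα i′) x} (T-∧ʳ {not (isLast M Xα i′)} u))
      all-below-α : ∀ j → toℕ j < lookup α x → T (lookup (lookup G₃ x) j)
      all-below-α j j<α = subst T (sym (lookup-G₃ x j)) (T-∧⁺ j∈G₂ (T-not⁺ (λ c → α≢p (Xₚ⇒α≡p x (proj₁ (C-sound x j c))))))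
        where
        s = ℕ.pred (lookup α x)
        α≡1+s : lookup α x ≡ suc s
        α≡1+s = sym (suc-pred (lookup α x) {{>-nonZero (≤-trans (s≤s z≤n) j<α)}})
        s<p : s < p
        s<p = subst (_≤ p) α≡1+s α≤p
        i₀ = fromℕ< s<p
        α≡1+i₀ : lookup α x ≡ suc (toℕ i₀)
        α≡1+i₀ = trans α≡1+s (cong suc (sym (toℕ-fromℕ< s<p)))
        x∈Xᵢ₀ = Xα-complete i₀ x α≡1+i₀
        i₀-not-last : T (not (isLast M Xα i₀))
        i₀-not-last = T-not⁺ (λ t → α≢p (trans α≡1+i₀ (≡ᵇ⇒≡ _ _ t)))
        j∈G₂ : T (lookup (lookup G₂ x) j)
        j∈G₂ = subst T (sym (lookup-G₂ x j)) (T-∧⁺ (⋃-complete Xα x i₀ x∈Xᵢ₀) (T-∨ʳ {toℕ j ≡ᵇ 0} (anyFin-complete _ i₀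
                 (T-∧⁺ i₀-not-last (T-∧⁺ x∈Xᵢ₀ (<⇒<ᵇ (subst (toℕ j <_) α≡1+i₀ j<α)))))))

    module Witness (l : ℤ) (ms : Vec ℤ p) (Σms≡0 : sumℤ ms ≡ ℤ.+ 0) (S : Vec (Subset n) p)
      (S-counted : T (allFin (λ t → indepOfSize M (l ℤ.+ lookup ms t) (lookup S t)) ∧ (multiplicity S ≡ᵥᵇ α))) where
      open Bases M

      S-block : ∀ t → T (indepOfSize M (l ℤ.+ lookup ms t) (lookup S t))
      S-block = allFin-sound _ (T-∧ˡ S-counted)

      multiplicity-S : ∀ x → lookup (multiplicity S) x ≡ lookup α x
      multiplicity-S = ≡ᵥᵇ-sound (multiplicity S) α (T-∧ʳ {allFin (λ t → indepOfSize M (l ℤ.+ lookup ms t) (lookup S t))} S-counted)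

      α≤p : ∀ x → lookup α x ≤ p
      α≤p x = subst (_≤ p) (trans (∣column∣≡multiplicity x S) (multiplicity-S x)) (∣p∣≤n (column x S))

      -- An element of multiplicity p lies in every block, in particular in the first one.
      Xₚ⊆S₀ : Xₚ ⊆ lookup S fz
      Xₚ⊆S₀ {x} x∈Xₚ = T⇒∈ (subst T (lookup-column x S fz)
        (∣p∣≡n⇒∈ (column x S) fz (trans (∣column∣≡multiplicity x S) (trans (multiplicity-S x) (Xₚ⇒α≡p x (∈⇒T x∈Xₚ))))))

      Xₚ-basis : IsBasis Xₚ Xₚ
      Xₚ-basis = (λ x∈ → x∈) , indep-down M Xₚ⊆S₀ (T-∧ˡ (S-block fz)) , (λ x∈ x∉ _ → x∉ x∈)

      open WithBasis Xₚ Xₚ-basis using (β)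

      β≡α : β ≡ α
      β≡α = vec-ext (λ x → trans (lookup∘tabulate (λ x → lookup α′ x + p * 𝟙 (lookup Xₚ x)) x)
                                 (trans (cong (_+ p * 𝟙 (lookup Xₚ x)) (lookup-map x ∣_∣ G₃)) (∣G₃∣+p·𝟙Xₚ≡α x (α≤p x))))

      k : ℤ
      k = l ℤ.- ℤ.+ ∣ Xₚ ∣

      l≡k+∣Xₚ∣ : l ≡ k ℤ.+ ℤ.+ ∣ Xₚ ∣
      l≡k+∣Xₚ∣ = ring l (ℤ.+ ∣ Xₚ ∣)
        where
        ring : ∀ l d → l ≡ (l ℤ.- d) ℤ.+ d
        ring = ℤRing.solve-∀

      depth≡l-k : ℤ.+ depth M Xα ≡ l ℤ.- k
      depth≡l-k = trans (cong ℤ.+_ (sym (∣basis∣≡rank Xₚ-basis))) (ring l (ℤ.+ ∣ Xₚ ∣))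
        where
        ring : ∀ l d → d ≡ l ℤ.- (l ℤ.- d)
        ring = ℤRing.solve-∀

      size≡p*k : ℤ.+ size (MXstd M Xα) ≡ ℤ.+ p ℤ.* k
      size≡p*k = cancel (ℤ.+ p) l (ℤ.+ ∣ Xₚ ∣) (ℤ.+ V.sum α′) (begin
          ℤ.+ V.sum α′ ℤ.+ ℤ.+ p ℤ.* ℤ.+ ∣ Xₚ ∣
        ≡⟨ cong (λ z → ℤ.+ V.sum α′ ℤ.+ z) (sym (ℤP.pos-* p ∣ Xₚ ∣)) ⟩
          ℤ.+ V.sum α′ ℤ.+ ℤ.+ (p * ∣ Xₚ ∣)
        ≡⟨ sym (ℤP.pos-+ (V.sum α′) (p * ∣ Xₚ ∣)) ⟩
          ℤ.+ (V.sum α′ + p * ∣ Xₚ ∣)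
        ≡⟨ cong ℤ.+_ (sym (sum-+*χ α α′ p Xₚ (λ x → sym (trans (cong (_+ p * 𝟙 (lookup Xₚ x)) (lookup-map x ∣_∣ G₃))
                                                                 (∣G₃∣+p·𝟙Xₚ≡α x (α≤p x)))))) ⟩
          ℤ.+ V.sum α
        ≡⟨ cong ℤ.+_ (trans (cong V.sum (sym (vec-ext {u = multiplicity S} {α} multiplicity-S))) (sum-multiplicity S)) ⟩
          ℤ.+ V.sum (V.map ∣_∣ S)
        ≡⟨ sum-sizes l S ms (λ t → toWitness (T-∧ʳ {indep M (lookup S t)} (S-block t))) ⟩
          ℤ.+ p ℤ.* l ℤ.+ sumℤ ms
        ≡⟨ cong (λ z → ℤ.+ p ℤ.* l ℤ.+ z) Σms≡0 ⟩
          ℤ.+ p ℤ.* l ℤ.+ ℤ.+ 0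
        ∎)
        where
        open ≡-Reasoning
        cancel : ∀ P l D A → A ℤ.+ P ℤ.* D ≡ P ℤ.* l ℤ.+ ℤ.+ 0 → A ≡ P ℤ.* (l ℤ.- D)
        cancel P l D A e = trans (ring₁ A P D) (trans (cong (ℤ._- (P ℤ.* D)) e) (ring₂ P l D))
          where
          ring₁ : ∀ A P D → A ≡ (A ℤ.+ P ℤ.* D) ℤ.- (P ℤ.* D)
          ring₁ = ℤRing.solve-∀
          ring₂ : ∀ P l D → (P ℤ.* l ℤ.+ ℤ.+ 0) ℤ.- (P ℤ.* D) ≡ P ℤ.* (l ℤ.- D)
          ring₂ = ℤRing.solve-∀

  module _ {n p′ : ℕ} (M : Matroid n) (l : ℤ) (ns ms : Vec ℤ (suc p′)) where
    private
      P : Vec ℤ (suc p′) → Poly n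
      P vs = prodP (V.map (λ a → fpoly (l ℤ.+ a) M) vs)

      π : ℤ → Vec ℤ (suc p′) → Vec (Subset n) (suc p′) → ℕ
      π k vs X = piCount (V.map (λ a → k ℤ.+ a) vs) (MXstd M X)

    fpoly-inequality⇒π-inequality : P ns ≥P P ms →
      ∀ k (X : Vec (Subset n) (suc p′)) → PairwiseDisjoint X → ℤ.+ depth M X ≡ l ℤ.- k → π k ms X ≤ π k ns X
    fpoly-inequality⇒π-inequality P≥ k X X-disjoint depth≡l-k with Bases.basis-of-rank M (lastBlock M X)
    ... | b₀ , b₀-basis , ∣b₀∣≡rank =
      subst₂ _≤_ (sym (piCount≡W*coefficient k l l≡k+∣b₀∣ ms)) (sym (piCount≡W*coefficient k l l≡k+∣b₀∣ ns))
        (*-monoʳ-≤ W (P≥ β))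
      where
      open Contraction M X X-disjoint
      open WithBasis b₀ b₀-basis
      l≡k+∣b₀∣ : l ≡ k ℤ.+ ℤ.+ ∣ b₀ ∣
      l≡k+∣b₀∣ = trans (ring l k) (cong (λ d → k ℤ.+ d) (trans (sym depth≡l-k) (cong ℤ.+_ (sym ∣b₀∣≡rank))))
        where
        ring : ∀ l k → l ≡ k ℤ.+ (l ℤ.- k)
        ring = ℤRing.solve-∀

    π-inequality⇒fpoly-inequality : sumℤ ms ≡ ℤ.+ 0 →
      (∀ k → k ℤ.≤ l → (X : Vec (Subset n) (suc p′)) → PairwiseDisjoint X →
         ℤ.+ size (MXstd M X) ≡ ℤ.+ (suc p′) ℤ.* k → ℤ.+ depth M X ≡ l ℤ.- k → π k ms X ≤ π k ns X) →
      P ns ≥P P ms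
    π-inequality⇒fpoly-inequality Σms≡0 π≤ α with P ms α ℕ.≟ 0
    ... | yes Pα≡0 = subst (_≤ P ns α) (sym Pα≡0) z≤n
    ... | no  Pα≢0 with ∑𝟙≢0⇒∃ (allVecs (suc p′) (allSubsets n)) _
                          (λ z → Pα≢0 (trans (prodP-fpoly-coefficient M (λ a → l ℤ.+ a) ms α) z))
    ...   | S , S-counted =
      subst₂ _≤_ (cong (P ms) β≡α) (cong (P ns) β≡α)
        (*-cancelˡ-≤ W (subst₂ _≤_ (piCount≡W*coefficient k l l≡k+∣Xₚ∣ ms) (piCount≡W*coefficient k l l≡k+∣Xₚ∣ ns)
          (π≤ k (ℤP.i≤j⇒i-k≤j (ℤ.+ ∣ Xₚ ∣) ℤP.≤-refl) Xα Xα-disjoint size≡p*k depth≡l-k)))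
      where
      open Realisation {n} {p′} M α
      open Witness l ms Σms≡0 S S-counted
      open WithBasis Xₚ Xₚ-basis using (piCount≡W*coefficient)

open import Data.Nat using (ℕ; _≤_; s≤s; z≤n)
open import Data.Integer using (ℤ; +_; _+_; _-_; _*_) renaming (_≤_ to _≤ℤ_)
open import Data.Vec using (Vec; map)
open import Data.Fin.Subset using (Subset)
open import Relation.Binary.PropositionalEquality using (_≡_)
open import Function.Bundles using (_⇔_; mk⇔)

theorem4p2 : {n : ℕ} (M : Matroid n) (p : ℕ) → 2 ≤ p → (l : ℤ) → + 1 ≤ℤ l →
    (ns ms : Vec ℤ p) → sumℤ ns ≡ + 0 → sumℤ ms ≡ + 0 →
    (prodP (map (λ ni → fpoly (l + ni) M) ns) ≥P prodP (map (λ mi → fpoly (l + mi) M) ms))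
    ⇔
    ((k : ℤ) → k ≤ℤ l → (X : Vec (Subset n) p) → PairwiseDisjoint X →
      + size (MXstd M X) ≡ + p * k → + depth M X ≡ l - k →
      piCount (map (λ mi → k + mi) ms) (MXstd M X) ≤ piCount (map (λ ni → k + ni) ns) (MXstd M X))
theorem4p2 M _ (s≤s (s≤s z≤n)) l _ ns ms _ Σms≡0 =
  mk⇔ (λ P≥ k _ X X-disjoint _ depth≡l-k → fpoly-inequality⇒π-inequality M l ns ms P≥ k X X-disjoint depth≡l-k)
      (π-inequality⇒fpoly-inequality M l ns ms Σms≡0)
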